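{- For all integers $k,n$ with $(k,n)\neq(-1,-1)$, $$a_{k+1,n+1}=a_{k,n}+a_{k-1,n+1}+a_{k+1,n-1}-a_{k-1,n-1}.$$
   Context: For nonnegative integers $p,q$, $a_{p,q}$ is the number of ways to partition a set consisting of $p$ marked points on a line and $q$ marked points on a parallel line into pairs, joining the two points of each pair by a straight segment, such that no two segments have a common point (in particular, no endpoint lies on another segment). Thus $a_{0,0}=1$, and $a_{p,q}=0$ when $p+q$ is odd. By convention $a_{p,q}=0$ if $p<0$ or $q<0$. -}

module Defs where

open import Data.Bool using (Bool; true; false; _∧_; _∨_; not; if_then_else_)
open import Data.Nat as ℕ using (ℕ; zero; suc; _<ᵇ_; _∸_)
open import Data.Fin using (Fin; toℕ)
import Data.Fin as F
open import Data.Integer as ℤ using (ℤ; +_; -[1+_])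
open import Data.Product using (_×_; _,_; proj₁; proj₂)
open import Data.List using (List; []; _∷_; map; concatMap; allFin; filterᵇ; foldr; length)
open import Data.Vec using (Vec; lookup) renaming ([] to []ᵛ; _∷_ to _∷ᵛ_)
open import Relation.Nullary.Decidable using (⌊_⌋)

-- Points of the configuration with p points on the line y = 1 and q
-- points on the parallel line y = 0.  Index i : Fin (p + q) with
-- toℕ i < p is the top point at (i , 1); otherwise the bottom point at
-- (i ∸ p , 0).  (Only the order of points on each line matters.)
Pt : Set
Pt = ℤ × ℤ

coord : (p q : ℕ) → Fin (p ℕ.+ q) → Pt
coord p q i =
  if toℕ i <ᵇ p then (+ toℕ i , + 1) else (+ (toℕ i ∸ p) , + 0)

cross : Pt → Pt → Pt → ℤ
cross (ax , ay) (bx , by) (cx , cy) =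
  (bx ℤ.- ax) ℤ.* (cy ℤ.- ay) ℤ.- (by ℤ.- ay) ℤ.* (cx ℤ.- ax)

infix 4 _<ℤ_ _≤ℤ_ _==ℤ_ _==F_

_<ℤ_ : ℤ → ℤ → Bool
x <ℤ y = ⌊ x ℤ.<? y ⌋

_≤ℤ_ : ℤ → ℤ → Bool
x ≤ℤ y = ⌊ x ℤ.≤? y ⌋

_==ℤ_ : ℤ → ℤ → Bool
x ==ℤ y = ⌊ x ℤ.≟ y ⌋

inBox : Pt → Pt → Pt → Bool
inBox (ax , ay) (bx , by) (cx , cy) =
  (ℤ._⊓_ ax bx ≤ℤ cx) ∧ (cx ≤ℤ ℤ._⊔_ ax bx) ∧
  (ℤ._⊓_ ay by ≤ℤ cy) ∧ (cy ≤ℤ ℤ._⊔_ ay by)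

onSeg : Pt → Pt → Pt → Bool
onSeg a b c = (cross a b c ==ℤ + 0) ∧ inBox a b c

segsMeet : Pt → Pt → Pt → Pt → Bool
segsMeet a b c d =
  ((d1 ℤ.* d2 <ℤ + 0) ∧ (d3 ℤ.* d4 <ℤ + 0))
  ∨ onSeg c d a ∨ onSeg c d b ∨ onSeg a b c ∨ onSeg a b d
  where
  d1 = cross c d a
  d2 = cross c d b
  d3 = cross a b c
  d4 = cross a b d

allᵇ : {A : Set} → (A → Bool) → List A → Bool
allᵇ f = foldr (λ x r → f x ∧ r) true

_==F_ : ∀ {n} → Fin n → Fin n → Bool
i ==F j = ⌊ i F.≟ j ⌋

-- A partition into pairs is encoded by its partner map v (v i = partner of i):
-- a fixed-point-free involution.  Distinct pairs {i, v i}, {j, v j} must give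
-- segments without common point.
validMatching : (p q : ℕ) → Vec (Fin (p ℕ.+ q)) (p ℕ.+ q) → Bool
validMatching p q v =
  allᵇ (λ i → (lookup v (lookup v i) ==F i) ∧ not (lookup v i ==F i)) pts
  ∧ allᵇ (λ i → allᵇ (λ j →
        (j ==F i) ∨ (j ==F lookup v i) ∨
        not (segsMeet (c i) (c (lookup v i)) (c j) (c (lookup v j)))) pts) pts
  where
  pts = allFin (p ℕ.+ q)
  c = coord p q

allVecs : (m n : ℕ) → List (Vec (Fin m) n)
allVecs m zero = []ᵛ ∷ []
allVecs m (suc n) = concatMap (λ x → map (x ∷ᵛ_) (allVecs m n)) (allFin m)

a : ℕ → ℕ → ℕ
a p q = length (filterᵇ (validMatching p q) (allVecs (p ℕ.+ q) (p ℕ.+ q)))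

aℤ : ℤ → ℤ → ℤ
aℤ (+ p) (+ q) = + a p q
aℤ (+ p) -[1+ q ] = + 0
aℤ -[1+ p ] _ = + 0

module Submission where

-- A matching of the p top and q bottom points (p, q ≥ 1) is non-crossing exactly
-- when its partner map is a fixed-point-free involution in which partners on the same line
-- are neighbours and top-to-bottom segments keep the left-to-right order ('Planar').  In
-- such a matching the first top point is paired (A) with the first bottom point, or (B)
-- with the second top point, or else (C) the first two bottom points are paired; A excludes
-- B and C.  Deleting the pair found in A, B, C or B∧C is a bijection onto the matchings of
-- a configuration with two points fewer, so inclusion–exclusion gives
--   a(p, q) + a(p-2, q-2) = a(p-1, q-1) + a(p-2, q) + a(p, q-2),
-- the recurrence at p = k+1, q = n+1.  The boundary rows (only one line occupied) and the
-- negative indices are checked separately.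

open import Defs
open import Data.Bool using (Bool; true; false; T; T?; _∧_; _∨_; not; if_then_else_)
import Data.Bool.Properties as BoolP
open import Data.Nat as ℕ using (ℕ; zero; suc; _<ᵇ_; _≡ᵇ_; _∸_; _<_; _≤_; _⊓_; _⊔_; z≤n; s≤s)
import Data.Nat.Properties as ℕP
open import Data.Integer as ℤ using (ℤ; +_; -[1+_]; _+_; _-_)
import Data.Integer.Properties as ℤP
open import Data.Integer.Tactic.RingSolver using (solve-∀)
open import Data.Fin as F using (Fin; toℕ)
import Data.Fin.Properties as FinP
open import Data.Vec using (Vec; lookup; tabulate) renaming ([] to []ᵛ; _∷_ to _∷ᵛ_)
import Data.Vec.Properties as VecP
open import Data.List using (List; []; _∷_; map; filterᵇ; length; allFin; concatMap; cartesianProductWith; _++_)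
import Data.List.Properties as ListP
open import Data.List.Membership.Propositional using (_∈_)
open import Data.List.Membership.Propositional.Properties using (∈-allFin; ∈-map⁺; ∈-map⁻; ∈-filter⁺; ∈-filter⁻; ∈-cartesianProductWith⁺)
open import Data.List.Membership.Propositional.Properties.WithK using (unique∧set⇒bag)
open import Data.List.Relation.Binary.BagAndSetEquality using (∼bag⇒↭)
open import Data.List.Relation.Binary.Permutation.Propositional.Properties using (↭-length)
open import Data.List.Relation.Unary.All as All using (All; []; _∷_)
open import Data.List.Relation.Unary.All.Properties using (all-filter)
open import Data.List.Relation.Unary.AllPairs using ([]; _∷_)
open import Data.List.Relation.Unary.Any using (here; there)
open import Data.List.Relation.Unary.Unique.Propositional using (Unique)
import Data.List.Relation.Unary.Unique.Propositional.Properties as UniqueP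
open import Data.Product using (Σ-syntax; _×_; _,_; proj₁; proj₂)
open import Data.Sum using (_⊎_; inj₁; inj₂; [_,_]′)
open import Data.Empty using (⊥; ⊥-elim)
open import Data.Unit using (tt)
open import Function using (_∘_)
open import Function.Bundles using (mk⇔; Equivalence)
open import Relation.Nullary using (¬_; Dec; yes; no)
open import Relation.Nullary.Decidable using (⌊_⌋)
open import Relation.Binary.PropositionalEquality
open import Relation.Binary.Definitions using (tri<; tri≈; tri>)


true≢false : true ≢ false
true≢false ()

<ᵇ-true : ∀ {m n} → m < n → (m <ᵇ n) ≡ true
<ᵇ-true {m} {n} m<n with m <ᵇ n | ℕP.<⇒<ᵇ m<n
... | true | _ = refl

<ᵇ-false : ∀ {m n} → n ≤ m → (m <ᵇ n) ≡ false
<ᵇ-false {m} {n} n≤m with m <ᵇ n | ℕP.<ᵇ⇒< m n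
... | false | _ = refl
... | true | m<n = ⊥-elim (ℕP.<⇒≱ (m<n tt) n≤m)

<ᵇ-true⁻ : ∀ {m n} → (m <ᵇ n) ≡ true → m < n
<ᵇ-true⁻ {m} {n} e = ℕP.<ᵇ⇒< m n (subst T (sym e) tt)

<ᵇ-false⁻ : ∀ {m n} → (m <ᵇ n) ≡ false → n ≤ m
<ᵇ-false⁻ e = ℕP.≮⇒≥ (λ m<n → true≢false (trans (sym (<ᵇ-true m<n)) e))

≡ᵇ-true : ∀ {m n} → m ≡ n → (m ≡ᵇ n) ≡ true
≡ᵇ-true {m} {n} m≡n with m ≡ᵇ n | ℕP.≡⇒≡ᵇ m n m≡n
... | true | _ = refl

≡ᵇ-true⁻ : ∀ {m n} → (m ≡ᵇ n) ≡ true → m ≡ n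
≡ᵇ-true⁻ {m} {n} e = ℕP.≡ᵇ⇒≡ m n (subst T (sym e) tt)

≡ᵇ-false : ∀ {m n} → m ≢ n → (m ≡ᵇ n) ≡ false
≡ᵇ-false {m} {n} m≢n with m ≡ᵇ n | ℕP.≡ᵇ⇒≡ m n
... | false | _ = refl
... | true | m≡n = ⊥-elim (m≢n (m≡n tt))

-- The partner map of a vector v, read as a function on indices (0 outside the range).
partner : ∀ {N k} → Vec (Fin N) k → ℕ → ℕ
partner []ᵛ x = 0
partner (i ∷ᵛ v) zero = toℕ i
partner (i ∷ᵛ v) (suc x) = partner v x

partner-lookup : ∀ {N k} (v : Vec (Fin N) k) (i : Fin k) → toℕ (lookup v i) ≡ partner v (toℕ i)
partner-lookup (_ ∷ᵛ v) F.zero = refl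
partner-lookup (_ ∷ᵛ v) (F.suc i) = partner-lookup v i

partner-< : ∀ {N k} (v : Vec (Fin N) k) x → x < k → partner v x < N
partner-< (i ∷ᵛ v) zero _ = FinP.toℕ<n i
partner-< (i ∷ᵛ v) (suc x) (s≤s x<k) = partner-< v x x<k

record Planar (N p : ℕ) (f : ℕ → ℕ) : Set where
  field
    bounded     : ∀ x → x < N → f x < N
    involutive  : ∀ x → x < N → f (f x) ≡ x
    no-fixpoint : ∀ x → x < N → f x ≢ x
    adjacent    : ∀ x → x < N → (x <ᵇ p) ≡ (f x <ᵇ p) → f x ≡ suc x ⊎ x ≡ suc (f x)
    monotone    : ∀ x y → x < y → y < p → p ≤ f x → p ≤ f y → f x < f y

⌊⌋-true : ∀ {P : Set} (d : Dec P) → P → ⌊ d ⌋ ≡ true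
⌊⌋-true (yes _) _ = refl
⌊⌋-true (no ¬p) p = ⊥-elim (¬p p)

⌊⌋-false : ∀ {P : Set} (d : Dec P) → ¬ P → ⌊ d ⌋ ≡ false
⌊⌋-false (yes p) ¬p = ⊥-elim (¬p p)
⌊⌋-false (no _) _ = refl

⌊⌋-true⁻ : ∀ {P : Set} (d : Dec P) → ⌊ d ⌋ ≡ true → P
⌊⌋-true⁻ (yes p) _ = p

⌊⌋-false⁻ : ∀ {P : Set} (d : Dec P) → ⌊ d ⌋ ≡ false → ¬ P
⌊⌋-false⁻ (no ¬p) _ = ¬p

height : Bool → ℤ
height true = + 1
height false = + 0

point : Bool → ℕ → Pt
point s x = (+ x , height s)

crossOnLines : Bool → Bool → Bool → ℕ → ℕ → ℕ → ℤ
crossOnLines true  true  true  a b c = + 0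
crossOnLines true  true  false a b c = + a ℤ.- + b
crossOnLines true  false true  a b c = + c ℤ.- + a
crossOnLines true  false false a b c = + c ℤ.- + b
crossOnLines false true  true  a b c = + b ℤ.- + c
crossOnLines false true  false a b c = + a ℤ.- + c
crossOnLines false false true  a b c = + b ℤ.- + a
crossOnLines false false false a b c = + 0

cross-point : ∀ s t u a b c → cross (point s a) (point t b) (point u c) ≡ crossOnLines s t u a b c
cross-point true  true  true  a b c = e111 (+ a) (+ b) (+ c)
  where e111 : ∀ A B C → (B ℤ.- A) ℤ.* (+ 1 ℤ.- + 1) ℤ.- (+ 1 ℤ.- + 1) ℤ.* (C ℤ.- A) ≡ + 0
        e111 = solve-∀
cross-point true  true  false a b c = e110 (+ a) (+ b) (+ c)
  where e110 : ∀ A B C → (B ℤ.- A) ℤ.* (+ 0 ℤ.- + 1) ℤ.- (+ 1 ℤ.- + 1) ℤ.* (C ℤ.- A) ≡ A ℤ.- B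
        e110 = solve-∀
cross-point true  false true  a b c = e101 (+ a) (+ b) (+ c)
  where e101 : ∀ A B C → (B ℤ.- A) ℤ.* (+ 1 ℤ.- + 1) ℤ.- (+ 0 ℤ.- + 1) ℤ.* (C ℤ.- A) ≡ C ℤ.- A
        e101 = solve-∀
cross-point true  false false a b c = e100 (+ a) (+ b) (+ c)
  where e100 : ∀ A B C → (B ℤ.- A) ℤ.* (+ 0 ℤ.- + 1) ℤ.- (+ 0 ℤ.- + 1) ℤ.* (C ℤ.- A) ≡ C ℤ.- B
        e100 = solve-∀
cross-point false true  true  a b c = e011 (+ a) (+ b) (+ c)
  where e011 : ∀ A B C → (B ℤ.- A) ℤ.* (+ 1 ℤ.- + 0) ℤ.- (+ 1 ℤ.- + 0) ℤ.* (C ℤ.- A) ≡ B ℤ.- C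
        e011 = solve-∀
cross-point false true  false a b c = e010 (+ a) (+ b) (+ c)
  where e010 : ∀ A B C → (B ℤ.- A) ℤ.* (+ 0 ℤ.- + 0) ℤ.- (+ 1 ℤ.- + 0) ℤ.* (C ℤ.- A) ≡ A ℤ.- C
        e010 = solve-∀
cross-point false false true  a b c = e001 (+ a) (+ b) (+ c)
  where e001 : ∀ A B C → (B ℤ.- A) ℤ.* (+ 1 ℤ.- + 0) ℤ.- (+ 0 ℤ.- + 0) ℤ.* (C ℤ.- A) ≡ B ℤ.- A
        e001 = solve-∀
cross-point false false false a b c = e000 (+ a) (+ b) (+ c)
  where e000 : ∀ A B C → (B ℤ.- A) ℤ.* (+ 0 ℤ.- + 0) ℤ.- (+ 0 ℤ.- + 0) ℤ.* (C ℤ.- A) ≡ + 0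
        e000 = solve-∀

-- Differences of naturals in normal form, so that signs of products compute.
difference-neg : ∀ a c → a < c → + a ℤ.- + c ≡ -[1+ (c ∸ suc a) ]
difference-neg a c a<c = trans (ℤP.[+m]-[+n]≡m⊖n a c)
  (trans (ℤP.⊖-< a<c) (cong (λ k → ℤ.- (+ k)) (ℕP.+-∸-assoc 1 a<c)))

difference-pos : ∀ a c → c < a → + a ℤ.- + c ≡ + suc (a ∸ suc c)
difference-pos a c c<a = trans (ℤP.[+m]-[+n]≡m⊖n a c)
  (trans (ℤP.⊖-≥ (ℕP.<⇒≤ c<a)) (cong +_ (ℕP.+-∸-assoc 1 c<a)))

difference-nonzero : ∀ a c → a ≢ c → (+ a ℤ.- + c ==ℤ + 0) ≡ false
difference-nonzero a c a≢c =
  ⌊⌋-false (+ a ℤ.- + c ℤ.≟ + 0) (λ e → a≢c (ℤP.+-injective (ℤP.i-j≡0⇒i≡j (+ a) (+ c) e)))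

product-same-order : ∀ a c b d → (a < c × b < d) ⊎ (c < a × d < b) →
  ((+ a ℤ.- + c) ℤ.* (+ b ℤ.- + d) <ℤ + 0) ≡ false
product-same-order a c b d (inj₁ (a<c , b<d)) rewrite difference-neg a c a<c | difference-neg b d b<d = refl
product-same-order a c b d (inj₂ (c<a , d<b)) rewrite difference-pos a c c<a | difference-pos b d d<b = refl

product-opposite-order : ∀ a c b d → a < c → d < b →
  ((+ a ℤ.- + c) ℤ.* (+ b ℤ.- + d) <ℤ + 0) ≡ true
product-opposite-order a c b d a<c d<b rewrite difference-neg a c a<c | difference-pos b d d<b = refl

product-opposite-order′ : ∀ a c b d → c < a → b < d →
  ((+ a ℤ.- + c) ℤ.* (+ b ℤ.- + d) <ℤ + 0) ≡ true
product-opposite-order′ a c b d c<a b<d rewrite difference-pos a c c<a | difference-neg b d b<d = refl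

horizontal-sides : ∀ s u v a b c d →
  (cross (point s a) (point s b) (point u c) ℤ.* cross (point s a) (point s b) (point v d) <ℤ + 0) ≡ false
horizontal-sides s u v a b c d rewrite cross-point s s u a b c | cross-point s s v a b d = sides s u v
  where
  square-nonneg : ∀ z → (z ℤ.* z <ℤ + 0) ≡ false
  square-nonneg (+ zero) = refl
  square-nonneg (+ suc n) = refl
  square-nonneg -[1+ n ] = refl
  times-zero : ∀ z → (z ℤ.* + 0 <ℤ + 0) ≡ false
  times-zero z rewrite ℤP.*-zeroʳ z = refl
  sides : ∀ s u v → (crossOnLines s s u a b c ℤ.* crossOnLines s s v a b d <ℤ + 0) ≡ false
  sides true true v = refl
  sides true false true = times-zero (+ a ℤ.- + b)
  sides true false false = square-nonneg (+ a ℤ.- + b)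
  sides false true true = square-nonneg (+ b ℤ.- + a)
  sides false true false = times-zero (+ b ℤ.- + a)
  sides false false v = refl

Between : ℕ → ℕ → ℕ → Set
Between a b c = a ⊓ b ≤ c × c ≤ a ⊔ b

inBox-false : ∀ a b c r → ¬ Between a b c →
  ((+ (a ⊓ b) ≤ℤ + c) ∧ ((+ c ≤ℤ + (a ⊔ b)) ∧ r)) ≡ false
inBox-false a b c r ¬btw with a ⊓ b ℕ.≤? c | c ℕ.≤? a ⊔ b
... | yes l | yes u = ⊥-elim (¬btw (l , u))
... | yes _ | no _ = refl
... | no _  | _ = refl

inBox-true : ∀ a b c → Between a b c →
  ((+ (a ⊓ b) ≤ℤ + c) ∧ ((+ c ≤ℤ + (a ⊔ b)) ∧ true)) ≡ true
inBox-true a b c (l , u)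
  rewrite ⌊⌋-true (+ (a ⊓ b) ℤ.≤? + c) (ℤ.+≤+ l) | ⌊⌋-true (+ c ℤ.≤? + (a ⊔ b)) (ℤ.+≤+ u) = refl

onSeg-false : ∀ s t u a b c → (u ≡ s → c ≢ a) → (u ≡ t → c ≢ b) →
  (s ≡ t → t ≡ u → ¬ Between a b c) →
  onSeg (point s a) (point t b) (point u c) ≡ false
onSeg-false s t u a b c ≢a ≢b ¬btw rewrite cross-point s t u a b c = cases s t u ≢a ≢b ¬btw
  where
  box-false : ∀ e x y → (e ∧ (x ∧ (y ∧ false))) ≡ false
  box-false true true true = refl
  box-false true true false = refl
  box-false true false y = refl
  box-false false x y = refl
  cases : ∀ s t u → (u ≡ s → c ≢ a) → (u ≡ t → c ≢ b) → (s ≡ t → t ≡ u → ¬ Between a b c) →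
    ((crossOnLines s t u a b c ==ℤ + 0) ∧ inBox (point s a) (point t b) (point u c)) ≡ false
  cases true true true _ _ ¬btw = inBox-false a b c true (¬btw refl refl)
  cases true true false _ _ _ = box-false (+ a ℤ.- + b ==ℤ + 0) (+ (a ⊓ b) ≤ℤ + c) (+ c ≤ℤ + (a ⊔ b))
  cases true false true ≢a _ _ rewrite difference-nonzero c a (≢a refl) = refl
  cases true false false _ ≢b _ rewrite difference-nonzero c b (≢b refl) = refl
  cases false true true _ ≢b _ rewrite difference-nonzero b c (λ e → ≢b refl (sym e)) = refl
  cases false true false ≢a _ _ rewrite difference-nonzero a c (λ e → ≢a refl (sym e)) = refl
  cases false false true _ _ _ = box-false (+ b ℤ.- + a ==ℤ + 0) (+ (a ⊓ b) ≤ℤ + c) (+ c ≤ℤ + (a ⊔ b))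
  cases false false false _ _ ¬btw = inBox-false a b c true (¬btw refl refl)

onSeg-true : ∀ s a b c → Between a b c → onSeg (point s a) (point s b) (point s c) ≡ true
onSeg-true s a b c btw rewrite cross-point s s s a b c = on s
  where
  on : ∀ s → ((crossOnLines s s s a b c ==ℤ + 0) ∧ inBox (point s a) (point s b) (point s c)) ≡ true
  on true = inBox-true a b c btw
  on false = inBox-true a b c btw

Separates : Pt → Pt → Pt → Pt → Bool
Separates a b c d = cross c d a ℤ.* cross c d b <ℤ + 0

SamePair : Pt → Pt → Pt → Pt → Set
SamePair a b a' b' = (a ≡ a' × b ≡ b') ⊎ (a ≡ b' × b ≡ a')

-- Separation depends only on the two unordered pairs: swapping c, d negates both factors.
separates-unordered : ∀ {a b c d a' b' c' d'} → SamePair a b a' b' → SamePair c d c' d' →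
  Separates a b c d ≡ Separates a' b' c' d'
separates-unordered (inj₁ (refl , refl)) (inj₁ (refl , refl)) = refl
separates-unordered {a} {b} {c} {d} (inj₂ (refl , refl)) (inj₁ (refl , refl)) =
  cong (_<ℤ + 0) (ℤP.*-comm (cross c d a) (cross c d b))
separates-unordered {a} {b} {c} {d} (inj₁ (refl , refl)) (inj₂ (refl , refl)) =
  cong (_<ℤ + 0) (swap-line c d a b)
  where
  negate-both : ∀ x y → (ℤ.- x) ℤ.* (ℤ.- y) ≡ x ℤ.* y
  negate-both = solve-∀
  cross-antisym : ∀ ax ay bx by cx cy →
    (ax ℤ.- bx) ℤ.* (cy ℤ.- by) ℤ.- (ay ℤ.- by) ℤ.* (cx ℤ.- bx)
    ≡ ℤ.- ((bx ℤ.- ax) ℤ.* (cy ℤ.- ay) ℤ.- (by ℤ.- ay) ℤ.* (cx ℤ.- ax))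
  cross-antisym = solve-∀
  swap-line : ∀ c d a b → cross c d a ℤ.* cross c d b ≡ cross d c a ℤ.* cross d c b
  swap-line (cx , cy) (dx , dy) (ax , ay) (bx , by) = sym (trans
    (cong₂ ℤ._*_ (cross-antisym cx cy dx dy ax ay) (cross-antisym cx cy dx dy bx by))
    (negate-both (cross (cx , cy) (dx , dy) (ax , ay)) (cross (cx , cy) (dx , dy) (bx , by))))
separates-unordered {a} {b} {c} {d} (inj₂ (refl , refl)) (inj₂ (refl , refl)) =
  trans (separates-unordered {a} {b} {c} {d} {b} {a} {c} {d} (inj₂ (refl , refl)) (inj₁ (refl , refl)))
        (separates-unordered {b} {a} {c} {d} {b} {a} {d} {c} (inj₁ (refl , refl)) (inj₂ (refl , refl)))

separates-cross-cross : ∀ t b t′ b′ →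
  Separates (point true t) (point false b) (point true t′) (point false b′)
  ≡ ((+ t ℤ.- + t′) ℤ.* (+ b ℤ.- + b′) <ℤ + 0)
separates-cross-cross t b t′ b′
  rewrite cross-point true false true t′ b′ t | cross-point true false false t′ b′ b = refl

offsetOn : Bool → ℕ → ℕ → ℕ
offsetOn true p x = x
offsetOn false p x = x ∸ p

offset : ℕ → ℕ → ℕ
offset p x = offsetOn (x <ᵇ p) p x

place : ℕ → ℕ → Pt
place p x = point (x <ᵇ p) (offset p x)

coord≡place : ∀ p q (i : Fin (p ℕ.+ q)) → coord p q i ≡ place p (toℕ i)
coord≡place p q i = by-line (toℕ i <ᵇ p)
  where
  by-line : ∀ b → (if b then (+ toℕ i , + 1) else (+ (toℕ i ∸ p) , + 0)) ≡ point b (offsetOn b p (toℕ i))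
  by-line true = refl
  by-line false = refl

place-top : ∀ {p x} → x < p → place p x ≡ point true x
place-top {p} {x} x<p = cong₂ (λ b y → point b y) (<ᵇ-true x<p) (cong (λ b → offsetOn b p x) (<ᵇ-true x<p))

place-bottom : ∀ {p x} → p ≤ x → place p x ≡ point false (x ∸ p)
place-bottom {p} {x} p≤x = cong₂ (λ b y → point b y) (<ᵇ-false p≤x) (cong (λ b → offsetOn b p x) (<ᵇ-false p≤x))

offset-injective : ∀ p z w → z ≢ w → (z <ᵇ p) ≡ (w <ᵇ p) → offset p z ≢ offset p w
offset-injective p z w z≢w same = by-line (z <ᵇ p) refl
  where
  by-line : ∀ b → (z <ᵇ p) ≡ b → offset p z ≢ offset p w
  by-line true ez e = z≢w (trans (sym (cong (λ b → offsetOn b p z) ez))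
                         (trans e (cong (λ b → offsetOn b p w) (trans (sym same) ez))))
  by-line false ez e = z≢w (ℕP.∸-cancelʳ-≡ {o = p} (<ᵇ-false⁻ ez) (<ᵇ-false⁻ (trans (sym same) ez))
                         (trans (sym (cong (λ b → offsetOn b p z) ez))
                           (trans e (cong (λ b → offsetOn b p w) (trans (sym same) ez)))))

offset-suc : ∀ p w → (w <ᵇ p) ≡ (suc w <ᵇ p) → offset p (suc w) ≡ suc (offset p w)
offset-suc p w same = by-line (w <ᵇ p) refl
  where
  by-line : ∀ b → (w <ᵇ p) ≡ b → offset p (suc w) ≡ suc (offset p w)
  by-line true ew = trans (cong (λ b → offsetOn b p (suc w)) (trans (sym same) ew))
                          (cong suc (sym (cong (λ b → offsetOn b p w) ew)))
  by-line false ew = trans (cong (λ b → offsetOn b p (suc w)) (trans (sym same) ew))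
                       (trans (ℕP.+-∸-assoc 1 {w} {p} (<ᵇ-false⁻ ew)) (cong suc (sym (cong (λ b → offsetOn b p w) ew))))

Between-sym : ∀ {a b c} → Between a b c → Between b a c
Between-sym {a} {b} {c} (l , u) = subst (_≤ c) (ℕP.⊓-comm a b) l , subst (c ≤_) (ℕP.⊔-comm a b) u

≤⇒Between : ∀ {a b c} → a ≤ c → c ≤ b → Between a b c
≤⇒Between a≤c c≤b rewrite ℕP.m≤n⇒m⊓n≡m (ℕP.≤-trans a≤c c≤b) | ℕP.m≤n⇒m⊔n≡n (ℕP.≤-trans a≤c c≤b) = a≤c , c≤b

¬Between-neighbours : ∀ a b c → b ≡ suc a ⊎ a ≡ suc b → c ≢ a → c ≢ b → ¬ Between a b c
¬Between-neighbours a .(suc a) c (inj₁ refl) c≢a c≢1+a (l , u)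
  rewrite ℕP.m≤n⇒m⊓n≡m (ℕP.n≤1+n a) | ℕP.m≤n⇒m⊔n≡n (ℕP.n≤1+n a) with ℕP.m≤n⇒m<n∨m≡n l
... | inj₂ a≡c = c≢a (sym a≡c)
... | inj₁ a<c = c≢1+a (ℕP.≤-antisym u a<c)
¬Between-neighbours .(suc b) b c (inj₂ refl) c≢1+b c≢b btw =
  ¬Between-neighbours b (suc b) c (inj₁ refl) c≢b c≢1+b (Between-sym btw)

on-line : ∀ {s A B C a b c} → A ≡ point s a → B ≡ point s b → C ≡ point s c → a ≤ c → c ≤ b →
  onSeg A B C ≡ true × onSeg B A C ≡ true
on-line {s} {a = a} {b} {c} refl refl refl a≤c c≤b =
  onSeg-true s a b c (≤⇒Between a≤c c≤b) , onSeg-true s b a c (Between-sym (≤⇒Between a≤c c≤b))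

between-on-segment : ∀ p a b c → a < c → c < b → (a <ᵇ p) ≡ (b <ᵇ p) →
  onSeg (place p a) (place p b) (place p c) ≡ true × onSeg (place p b) (place p a) (place p c) ≡ true
between-on-segment p a b c a<c c<b same with a ℕ.<? p
... | yes a<p = on-line {true} (place-top {p} {a} a<p) (place-top {p} {b} b<p) (place-top {p} {c} (ℕP.<-trans c<b b<p))
                 (ℕP.<⇒≤ a<c) (ℕP.<⇒≤ c<b)
  where
  b<p = <ᵇ-true⁻ (trans (sym same) (<ᵇ-true a<p))
... | no a≮p = on-line {false} (place-bottom {p} {a} p≤a) (place-bottom {p} {b} (<ᵇ-false⁻ (trans (sym same) (<ᵇ-false p≤a))))
                 (place-bottom {p} {c} (ℕP.≤-trans p≤a (ℕP.<⇒≤ a<c)))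
                 (ℕP.∸-monoˡ-≤ p (ℕP.<⇒≤ a<c)) (ℕP.∸-monoˡ-≤ p (ℕP.<⇒≤ c<b))
  where
  p≤a = ℕP.≮⇒≥ a≮p

module PlanarGeometry {N p : ℕ} {f : ℕ → ℕ} (G : Planar N p f) where
  open Planar G

  adjacent-offsets : ∀ w → w < N → (w <ᵇ p) ≡ (f w <ᵇ p) →
    offset p (f w) ≡ suc (offset p w) ⊎ offset p w ≡ suc (offset p (f w))
  adjacent-offsets w w<N same with adjacent w w<N same
  ... | inj₁ fw≡1+w = inj₁ (trans (cong (offset p) fw≡1+w)
                             (offset-suc p w (trans same (cong (_<ᵇ p) fw≡1+w))))
  ... | inj₂ w≡1+fw = inj₂ (trans (cong (offset p) w≡1+fw)
                             (offset-suc p (f w) (trans (sym same) (cong (_<ᵇ p) w≡1+fw))))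

  not-on-segment : ∀ w z → w < N → z ≢ w → z ≢ f w → onSeg (place p w) (place p (f w)) (place p z) ≡ false
  not-on-segment w z w<N z≢w z≢fw =
    onSeg-false (w <ᵇ p) (f w <ᵇ p) (z <ᵇ p) (offset p w) (offset p (f w)) (offset p z)
      (offset-injective p z w z≢w) (offset-injective p z (f w) z≢fw) not-between
    where
    not-between : (w <ᵇ p) ≡ (f w <ᵇ p) → (f w <ᵇ p) ≡ (z <ᵇ p) →
      ¬ Between (offset p w) (offset p (f w)) (offset p z)
    not-between same₁ same₂ = ¬Between-neighbours _ _ _ (adjacent-offsets w w<N same₁)
      (offset-injective p z w z≢w (sym (trans same₁ same₂)))
      (offset-injective p z (f w) z≢fw (sym same₂))

  horizontal-apart : ∀ x y y′ → (x <ᵇ p) ≡ (f x <ᵇ p) →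
    Separates (place p y) (place p y′) (place p x) (place p (f x)) ≡ false
  horizontal-apart x y y′ same =
    subst (λ b → Separates (place p y) (place p y′) (place p x) (point b (offset p (f x))) ≡ false) same
      (horizontal-sides (x <ᵇ p) (y <ᵇ p) (y′ <ᵇ p) (offset p x) (offset p (f x)) (offset p y) (offset p y′))

  -- Two top-to-bottom pairs, given by their top ends, are in the same order at both ends
  -- (monotonicity), so neither separates the endpoints of the other.
  cross-pairs-apart : ∀ u v → u < p → v < p → p ≤ f u → p ≤ f v → u ≢ v →
    Separates (place p u) (place p (f u)) (place p v) (place p (f v)) ≡ false
  cross-pairs-apart u v u<p v<p p≤fu p≤fv u≢v =
    trans (separates-unordered (inj₁ (place-top u<p , place-bottom p≤fu)) (inj₁ (place-top v<p , place-bottom p≤fv)))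
      (trans (separates-cross-cross u (f u ∸ p) v (f v ∸ p)) same-order)
    where
    same-order : ((+ u ℤ.- + v) ℤ.* (+ (f u ∸ p) ℤ.- + (f v ∸ p)) <ℤ + 0) ≡ false
    same-order with ℕP.<-cmp u v
    ... | tri< u<v _ _ = product-same-order u v (f u ∸ p) (f v ∸ p)
                           (inj₁ (u<v , ℕP.∸-monoˡ-< (monotone u v u<v v<p p≤fu p≤fv) p≤fu))
    ... | tri≈ _ u≡v _ = ⊥-elim (u≢v u≡v)
    ... | tri> _ _ v<u = product-same-order u v (f u ∸ p) (f v ∸ p)
                           (inj₂ (v<u , ℕP.∸-monoˡ-< (monotone v u v<u u<p p≤fv p≤fu) p≤fv))

  PairOf : ℕ → ℕ → Set
  PairOf x u = (x ≡ u × f x ≡ f u) ⊎ (x ≡ f u × f x ≡ u)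

  top-end : ∀ x → x < N → (x <ᵇ p) ≢ (f x <ᵇ p) → Σ[ u ∈ ℕ ] u < p × p ≤ f u × PairOf x u
  top-end x x<N different with x <ᵇ p in ex | f x <ᵇ p in efx
  ... | true  | true  = ⊥-elim (different refl)
  ... | true  | false = x , <ᵇ-true⁻ ex , <ᵇ-false⁻ efx , inj₁ (refl , refl)
  ... | false | true  = f x , <ᵇ-true⁻ efx , subst (p ≤_) (sym (involutive x x<N)) (<ᵇ-false⁻ ex)
                          , inj₂ (sym (involutive x x<N) , refl)
  ... | false | false = ⊥-elim (different refl)

  pair-places : ∀ {x u} → PairOf x u → SamePair (place p x) (place p (f x)) (place p u) (place p (f u))
  pair-places (inj₁ (x≡u , fx≡fu)) = inj₁ (cong (place p) x≡u , cong (place p) fx≡fu)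
  pair-places (inj₂ (x≡fu , fx≡u)) = inj₂ (cong (place p) x≡fu , cong (place p) fx≡u)

  distinct-tops : ∀ x y → x < N → y < N → y ≢ x → y ≢ f x → ∀ {u v} → PairOf x u → PairOf y v → u ≢ v
  distinct-tops x y x<N y<N y≢x y≢fx (inj₁ (x≡u , _)) (inj₁ (y≡v , _)) u≡v =
    y≢x (trans y≡v (trans (sym u≡v) (sym x≡u)))
  distinct-tops x y x<N y<N y≢x y≢fx (inj₁ (x≡u , _)) (inj₂ (_ , fy≡v)) u≡v =
    y≢fx (trans (sym (involutive y y<N)) (cong f (trans fy≡v (trans (sym u≡v) (sym x≡u)))))
  distinct-tops x y x<N y<N y≢x y≢fx (inj₂ (_ , fx≡u)) (inj₁ (y≡v , _)) u≡v =
    y≢fx (trans y≡v (trans (sym u≡v) (sym fx≡u)))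
  distinct-tops x y x<N y<N y≢x y≢fx (inj₂ (_ , fx≡u)) (inj₂ (_ , fy≡v)) u≡v =
    y≢x (trans (sym (involutive y y<N))
          (trans (cong f (trans fy≡v (trans (sym u≡v) (sym fx≡u)))) (involutive x x<N)))

  no-proper-crossing : ∀ x y → x < N → y < N → y ≢ x → y ≢ f x →
    Separates (place p x) (place p (f x)) (place p y) (place p (f y)) ≡ false
    ⊎ Separates (place p y) (place p (f y)) (place p x) (place p (f x)) ≡ false
  no-proper-crossing x y x<N y<N y≢x y≢fx
    with (x <ᵇ p) BoolP.≟ (f x <ᵇ p) | (y <ᵇ p) BoolP.≟ (f y <ᵇ p)
  ... | yes x-horizontal | _ = inj₂ (horizontal-apart x y (f y) x-horizontal)
  ... | no _ | yes y-horizontal = inj₁ (horizontal-apart y x (f x) y-horizontal)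
  ... | no x-cross | no y-cross with top-end x x<N x-cross | top-end y y<N y-cross
  ...   | u , u<p , p≤fu , x~u | v , v<p , p≤fv , y~v =
    inj₁ (trans (separates-unordered (pair-places x~u) (pair-places y~v))
                (cross-pairs-apart u v u<p v<p p≤fu p≤fv (distinct-tops x y x<N y<N y≢x y≢fx x~u y~v)))

segsMeet-false : ∀ a b c d → onSeg c d a ≡ false → onSeg c d b ≡ false → onSeg a b c ≡ false → onSeg a b d ≡ false →
  Separates a b c d ≡ false ⊎ Separates c d a b ≡ false → segsMeet a b c d ≡ false
segsMeet-false a b c d e₁ e₂ e₃ e₄ (inj₁ e) rewrite e₁ | e₂ | e₃ | e₄ | e = refl
segsMeet-false a b c d e₁ e₂ e₃ e₄ (inj₂ e) rewrite e₁ | e₂ | e₃ | e₄ | e | BoolP.∧-zeroʳ (Separates a b c d) = refl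

segsMeet-onSeg : ∀ a b c d → onSeg a b c ≡ true → segsMeet a b c d ≡ true
segsMeet-onSeg a b c d e rewrite e = ∨-true (Separates a b c d ∧ Separates c d a b) (onSeg c d a) (onSeg c d b)
  where
  ∨-true : ∀ x y z → (x ∨ (y ∨ (z ∨ (true ∨ onSeg a b d)))) ≡ true
  ∨-true true y z = refl
  ∨-true false true z = refl
  ∨-true false false true = refl
  ∨-true false false false = refl

segsMeet-proper : ∀ a b c d → Separates a b c d ≡ true → Separates c d a b ≡ true → segsMeet a b c d ≡ true
segsMeet-proper a b c d e₁ e₂ rewrite e₁ | e₂ = refl

allᵇ-∈ : ∀ {A : Set} (P : A → Bool) xs → allᵇ P xs ≡ true → ∀ {x} → x ∈ xs → P x ≡ true
allᵇ-∈ P (y ∷ xs) h (here refl) with P y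
... | true = refl
allᵇ-∈ P (y ∷ xs) h (there x∈xs) with P y
... | true = allᵇ-∈ P xs h x∈xs

allᵇ-intro : ∀ {A : Set} (P : A → Bool) xs → (∀ {x} → x ∈ xs → P x ≡ true) → allᵇ P xs ≡ true
allᵇ-intro P [] _ = refl
allᵇ-intro P (y ∷ xs) h rewrite h (here refl) = allᵇ-intro P xs (λ m → h (there m))

∧-true⁻ : ∀ {x y} → (x ∧ y) ≡ true → x ≡ true × y ≡ true
∧-true⁻ {true} {true} _ = refl , refl

∧-true : ∀ {x y} → x ≡ true → y ≡ true → (x ∧ y) ≡ true
∧-true refl refl = refl

module Validity (p q : ℕ) (v : Vec (Fin (p ℕ.+ q)) (p ℕ.+ q)) where
  private
    f = partner v
    fin : ∀ {x} → x < p ℕ.+ q → Fin (p ℕ.+ q)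
    fin x<N = F.fromℕ< x<N
    toℕ-fin : ∀ {x} (x<N : x < p ℕ.+ q) → toℕ (fin x<N) ≡ x
    toℕ-fin x<N = FinP.toℕ-fromℕ< x<N

  IsPaired : Fin (p ℕ.+ q) → Bool
  IsPaired i = (lookup v (lookup v i) ==F i) ∧ not (lookup v i ==F i)

  Disjoint : Fin (p ℕ.+ q) → Fin (p ℕ.+ q) → Bool
  Disjoint i j = (j ==F i) ∨ (j ==F lookup v i) ∨
    not (segsMeet (coord p q i) (coord p q (lookup v i)) (coord p q j) (coord p q (lookup v j)))

  segsMeet-places : ∀ i j →
    segsMeet (coord p q i) (coord p q (lookup v i)) (coord p q j) (coord p q (lookup v j))
    ≡ segsMeet (place p (toℕ i)) (place p (f (toℕ i))) (place p (toℕ j)) (place p (f (toℕ j)))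
  segsMeet-places i j = cong₂ (λ (A , B) (C , D) → segsMeet A B C D)
    (cong₂ _,_ (coord≡place p q i) (at-partner i)) (cong₂ _,_ (coord≡place p q j) (at-partner j))
    where
    at-partner : ∀ i → coord p q (lookup v i) ≡ place p (f (toℕ i))
    at-partner i = trans (coord≡place p q (lookup v i)) (cong (place p) (partner-lookup v i))

  module FromValid (valid : validMatching p q v ≡ true) where
    is-paired : ∀ i → IsPaired i ≡ true
    is-paired i = allᵇ-∈ IsPaired (allFin _) (proj₁ (∧-true⁻ valid)) (∈-allFin i)

    disjoint : ∀ i j → Disjoint i j ≡ true
    disjoint i j = allᵇ-∈ (Disjoint i) (allFin _)
      (allᵇ-∈ (λ i → allᵇ (Disjoint i) (allFin _)) (allFin _) (proj₂ (∧-true⁻ valid)) (∈-allFin i)) (∈-allFin j)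

    involutive : ∀ x → x < p ℕ.+ q → f (f x) ≡ x
    involutive x x<N = begin
      f (f x)                        ≡⟨ cong (λ k → f (f k)) (sym (toℕ-fin x<N)) ⟩
      f (f (toℕ i))                  ≡⟨ sym (trans (partner-lookup v (lookup v i)) (cong f (partner-lookup v i))) ⟩
      toℕ (lookup v (lookup v i))    ≡⟨ cong toℕ (⌊⌋-true⁻ (lookup v (lookup v i) F.≟ i) (proj₁ (∧-true⁻ (is-paired i)))) ⟩
      toℕ i                          ≡⟨ toℕ-fin x<N ⟩
      x                              ∎
      where
      open ≡-Reasoning
      i = fin x<N

    no-fixpoint : ∀ x → x < p ℕ.+ q → f x ≢ x
    no-fixpoint x x<N fx≡x = ⌊⌋-false⁻ (lookup v i F.≟ i) (not-true (proj₂ (∧-true⁻ (is-paired i))))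
      (FinP.toℕ-injective (trans (partner-lookup v i) (trans (cong f (toℕ-fin x<N)) (trans fx≡x (sym (toℕ-fin x<N))))))
      where
      i = fin x<N
      not-true : ∀ {b} → not b ≡ true → b ≡ false
      not-true {false} _ = refl

    disjoint-segments : ∀ x y → x < p ℕ.+ q → y < p ℕ.+ q → y ≢ x → y ≢ f x →
      segsMeet (place p x) (place p (f x)) (place p y) (place p (f y)) ≡ false
    disjoint-segments x y x<N y<N y≢x y≢fx =
      subst₂ (λ a b → segsMeet (place p a) (place p (f a)) (place p b) (place p (f b)) ≡ false) (toℕ-fin x<N) (toℕ-fin y<N)
        (trans (sym (segsMeet-places i j)) (third (≢-false j≢i) (≢-false j≢fi) (disjoint i j)))
      where
      i = fin x<N
      j = fin y<N
      j≢i : j ≢ i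
      j≢i e = y≢x (trans (sym (toℕ-fin y<N)) (trans (cong toℕ e) (toℕ-fin x<N)))
      j≢fi : j ≢ lookup v i
      j≢fi e = y≢fx (trans (sym (toℕ-fin y<N)) (trans (cong toℕ e) (trans (partner-lookup v i) (cong f (toℕ-fin x<N)))))
      ≢-false : ∀ {k l : Fin (p ℕ.+ q)} → k ≢ l → (k ==F l) ≡ false
      ≢-false {k} {l} k≢l = ⌊⌋-false (k F.≟ l) k≢l
      third : ∀ {a b c} → a ≡ false → b ≡ false → (a ∨ b ∨ not c) ≡ true → c ≡ false
      third {c = false} refl refl _ = refl

    inner-point : ∀ x z → x < p ℕ.+ q → z < p ℕ.+ q → z ≢ x → z ≢ f x →
      onSeg (place p x) (place p (f x)) (place p z) ≡ true → ⊥
    inner-point x z x<N z<N z≢x z≢fx on = true≢false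
      (trans (sym (segsMeet-onSeg (place p x) (place p (f x)) (place p z) (place p (f z)) on)) (disjoint-segments x z x<N z<N z≢x z≢fx))

    adjacent : ∀ x → x < p ℕ.+ q → (x <ᵇ p) ≡ (f x <ᵇ p) → f x ≡ suc x ⊎ x ≡ suc (f x)
    adjacent x x<N same with f x ℕ.≟ suc x | x ℕ.≟ suc (f x)
    ... | yes fx≡1+x | _ = inj₁ fx≡1+x
    ... | no _ | yes x≡1+fx = inj₂ x≡1+fx
    ... | no fx≢1+x | no x≢1+fx with ℕP.<-cmp x (f x)
    ...   | tri< x<fx _ _ = ⊥-elim (inner-point x (suc x) x<N (ℕP.<-trans 1+x<fx (partner-< v x x<N))
                              (ℕP.1+n≢n) (λ e → fx≢1+x (sym e))
                              (proj₁ (between-on-segment p x (f x) (suc x) (ℕP.n<1+n x) 1+x<fx same)))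
      where
      1+x<fx : suc x < f x
      1+x<fx = ℕP.≤∧≢⇒< x<fx (λ e → fx≢1+x (sym e))
    ...   | tri≈ _ x≡fx _ = ⊥-elim (no-fixpoint x x<N (sym x≡fx))
    ...   | tri> _ _ fx<x = ⊥-elim (inner-point x (suc (f x)) x<N (ℕP.<-trans 1+fx<x x<N)
                              (λ e → x≢1+fx (sym e)) ℕP.1+n≢n
                              (proj₂ (between-on-segment p (f x) x (suc (f x)) (ℕP.n<1+n (f x)) 1+fx<x (sym same))))
      where
      1+fx<x : suc (f x) < x
      1+fx<x = ℕP.≤∧≢⇒< fx<x (λ e → x≢1+fx (sym e))

    monotone : ∀ x y → x < y → y < p → p ≤ f x → p ≤ f y → f x < f y
    monotone x y x<y y<p p≤fx p≤fy with ℕP.<-cmp (f x) (f y)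
    ... | tri< fx<fy _ _ = fx<fy
    ... | tri≈ _ fx≡fy _ = ⊥-elim (ℕP.<-irrefl (trans (sym (involutive x x<N)) (trans (cong f fx≡fy) (involutive y y<N))) x<y)
      where
      y<N = ℕP.<-≤-trans y<p (ℕP.m≤m+n p q)
      x<N = ℕP.<-trans x<y y<N
    ... | tri> _ _ fy<fx = ⊥-elim (true≢false (trans (sym crossing) (disjoint-segments x y x<N y<N
                               (λ e → ℕP.<-irrefl (sym e) x<y) (λ e → ℕP.<-irrefl refl (ℕP.<-≤-trans (subst (_< p) e y<p) p≤fx)))))
      where
      y<N = ℕP.<-≤-trans y<p (ℕP.m≤m+n p q)
      x<N = ℕP.<-trans x<y y<N
      fy′<fx′ : f y ∸ p < f x ∸ p
      fy′<fx′ = ℕP.∸-monoˡ-< fy<fx p≤fy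
      x-pair = inj₁ (place-top (ℕP.<-trans x<y y<p) , place-bottom p≤fx)
      y-pair = inj₁ (place-top y<p , place-bottom p≤fy)
      crossing : segsMeet (place p x) (place p (f x)) (place p y) (place p (f y)) ≡ true
      crossing = segsMeet-proper (place p x) (place p (f x)) (place p y) (place p (f y))
        (trans (separates-unordered x-pair y-pair)
          (trans (separates-cross-cross x (f x ∸ p) y (f y ∸ p)) (product-opposite-order x y _ _ x<y fy′<fx′)))
        (trans (separates-unordered y-pair x-pair)
          (trans (separates-cross-cross y (f y ∸ p) x (f x ∸ p)) (product-opposite-order′ y x _ _ x<y fy′<fx′)))

    planar : Planar (p ℕ.+ q) p f
    planar = record
      { bounded = partner-< v ; involutive = involutive ; no-fixpoint = no-fixpoint
      ; adjacent = adjacent ; monotone = monotone }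

  module FromPlanar (G : Planar (p ℕ.+ q) p f) where
    open Planar G
    open PlanarGeometry G

    disjoint-segments : ∀ x y → x < p ℕ.+ q → y < p ℕ.+ q → y ≢ x → y ≢ f x →
      segsMeet (place p x) (place p (f x)) (place p y) (place p (f y)) ≡ false
    disjoint-segments x y x<N y<N y≢x y≢fx = segsMeet-false (place p x) (place p (f x)) (place p y) (place p (f y))
      (not-on-segment y x y<N (λ e → y≢x (sym e)) x≢fy)
      (not-on-segment y (f x) y<N (λ e → y≢fx (sym e)) fx≢fy)
      (not-on-segment x y x<N y≢x y≢fx)
      (not-on-segment x (f y) x<N (λ e → x≢fy (sym e)) (λ e → fx≢fy (sym e)))
      (no-proper-crossing x y x<N y<N y≢x y≢fx)
      where
      x≢fy : x ≢ f y
      x≢fy e = y≢fx (sym (trans (cong f e) (involutive y y<N)))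
      fx≢fy : f x ≢ f y
      fx≢fy e = y≢x (sym (trans (sym (involutive x x<N)) (trans (cong f e) (involutive y y<N))))

    is-paired : ∀ i → IsPaired i ≡ true
    is-paired i = ∧-true (⌊⌋-true (lookup v (lookup v i) F.≟ i) (FinP.toℕ-injective twice))
                         (cong not (⌊⌋-false (lookup v i F.≟ i) (λ e → no-fixpoint (toℕ i) (FinP.toℕ<n i)
                                                                   (trans (sym (partner-lookup v i)) (cong toℕ e)))))
      where
      twice : toℕ (lookup v (lookup v i)) ≡ toℕ i
      twice = trans (partner-lookup v (lookup v i)) (trans (cong f (partner-lookup v i)) (involutive (toℕ i) (FinP.toℕ<n i)))

    disjoint : ∀ i j → Disjoint i j ≡ true
    disjoint i j with j F.≟ i | j F.≟ lookup v i
    ... | yes _ | _ = refl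
    ... | no _ | yes _ = refl
    ... | no j≢i | no j≢fi = cong not (trans (segsMeet-places i j)
            (disjoint-segments (toℕ i) (toℕ j) (FinP.toℕ<n i) (FinP.toℕ<n j) (λ e → j≢i (FinP.toℕ-injective e))
               (λ e → j≢fi (FinP.toℕ-injective (trans e (sym (partner-lookup v i)))))))

    valid : validMatching p q v ≡ true
    valid = ∧-true (allᵇ-intro IsPaired (allFin _) (λ {i} _ → is-paired i))
                   (allᵇ-intro (λ i → allᵇ (Disjoint i) (allFin _)) (allFin _)
                      (λ {i} _ → allᵇ-intro (Disjoint i) (allFin _) (λ {j} _ → disjoint i j)))

valid⇒planar : ∀ p q (v : Vec (Fin (p ℕ.+ q)) (p ℕ.+ q)) → validMatching p q v ≡ true → Planar (p ℕ.+ q) p (partner v)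
valid⇒planar p q v valid = Validity.FromValid.planar p q v valid

planar⇒valid : ∀ p q (v : Vec (Fin (p ℕ.+ q)) (p ℕ.+ q)) → Planar (p ℕ.+ q) p (partner v) → validMatching p q v ≡ true
planar⇒valid p q v G = Validity.FromPlanar.valid p q v G

count : {A : Set} → (A → Bool) → List A → ℕ
count P xs = length (filterᵇ P xs)

module _ {A : Set} where
  private
    T⇒≡ : ∀ {b} → T b → b ≡ true
    T⇒≡ = Equivalence.to BoolP.T-≡
    ≡⇒T : ∀ {b} → b ≡ true → T b
    ≡⇒T = Equivalence.from BoolP.T-≡

  count-cong : (P Q : A → Bool) → (∀ x → P x ≡ Q x) → ∀ xs → count P xs ≡ count Q xs
  count-cong P Q P≗Q xs = cong length
    (ListP.filter-≐ (T? ∘ P) (T? ∘ Q) ((λ {x} → subst T (P≗Q x)) , (λ {x} → subst T (sym (P≗Q x)))) xs)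

  count-none : (P : A → Bool) → (∀ x → P x ≡ false) → ∀ xs → count P xs ≡ 0
  count-none P never xs = cong length
    (ListP.filter-none (T? ∘ P) (All.universal (λ x → subst T (never x)) xs))

  count-∨ : (P Q : A → Bool) → ∀ xs → count (λ x → P x ∨ Q x) xs ℕ.+ count (λ x → P x ∧ Q x) xs ≡ count P xs ℕ.+ count Q xs
  count-∨ P Q [] = refl
  count-∨ P Q (x ∷ xs) with P x | Q x
  ... | true  | true  = cong suc (trans (ℕP.+-suc _ _) (trans (cong suc (count-∨ P Q xs)) (sym (ℕP.+-suc _ _))))
  ... | true  | false = cong suc (count-∨ P Q xs)
  ... | false | true  = trans (cong suc (count-∨ P Q xs)) (sym (ℕP.+-suc _ _))
  ... | false | false = count-∨ P Q xs

  ∈-filterᵇ⁺ : (P : A → Bool) → ∀ {x xs} → x ∈ xs → P x ≡ true → x ∈ filterᵇ P xs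
  ∈-filterᵇ⁺ P x∈xs Px = ∈-filter⁺ (T? ∘ P) x∈xs (≡⇒T Px)

  ∈-filterᵇ⁻ : (P : A → Bool) → ∀ {x xs} → x ∈ filterᵇ P xs → P x ≡ true
  ∈-filterᵇ⁻ P {xs = xs} m = T⇒≡ (proj₂ (∈-filter⁻ (T? ∘ P) {xs = xs} m))

map-unique : ∀ {A B : Set} (P : A → Bool) (F : A → B) (G : B → A) → (∀ x → P x ≡ true → G (F x) ≡ x) →
  ∀ xs → All (λ x → P x ≡ true) xs → Unique xs → Unique (map F xs)
map-unique P F G GF [] _ _ = []
map-unique P F G GF (x ∷ xs) (px ∷ pxs) (x∉xs ∷ u) = apart xs pxs x∉xs ∷ map-unique P F G GF xs pxs u
  where
  apart : ∀ ys → All (λ y → P y ≡ true) ys → All (λ y → x ≢ y) ys → All (λ y → F x ≢ y) (map F ys)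
  apart [] _ _ = []
  apart (y ∷ ys) (py ∷ pys) (x≢y ∷ ne) = (λ e → x≢y (trans (sym (GF x px)) (trans (cong G e) (GF y py)))) ∷ apart ys pys ne

count-bijection : ∀ {A B : Set} (P : A → Bool) (Q : B → Bool) (xs : List A) (ys : List B) →
  Unique xs → Unique ys → (∀ x → x ∈ xs) → (∀ y → y ∈ ys) →
  (F : A → B) (G : B → A) → (∀ x → P x ≡ true → Q (F x) ≡ true) → (∀ y → Q y ≡ true → P (G y) ≡ true) →
  (∀ x → P x ≡ true → G (F x) ≡ x) → (∀ y → Q y ≡ true → F (G y) ≡ y) →
  count P xs ≡ count Q ys
count-bijection P Q xs ys uxs uys all-xs all-ys F G PQ QP GF FG =
  trans (sym (ListP.length-map F (filterᵇ P xs)))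
    (↭-length (∼bag⇒↭ (unique∧set⇒bag image-unique (UniqueP.filter⁺ (T? ∘ Q) uys) (mk⇔ to from))))
  where
  image-unique : Unique (map F (filterᵇ P xs))
  image-unique = map-unique P F G GF (filterᵇ P xs)
    (All.map (Equivalence.to BoolP.T-≡) (all-filter (T? ∘ P) xs)) (UniqueP.filter⁺ (T? ∘ P) uxs)
  to : ∀ {y} → y ∈ map F (filterᵇ P xs) → y ∈ filterᵇ Q ys
  to m with ∈-map⁻ F m
  ... | x , x∈ , refl = ∈-filterᵇ⁺ Q (all-ys (F x)) (PQ x (∈-filterᵇ⁻ P {xs = xs} x∈))
  from : ∀ {y} → y ∈ filterᵇ Q ys → y ∈ map F (filterᵇ P xs)
  from {y} m = subst (_∈ map F (filterᵇ P xs)) (FG y Qy) (∈-map⁺ F (∈-filterᵇ⁺ P (all-xs (G y)) (QP y Qy)))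
    where
    Qy = ∈-filterᵇ⁻ Q {xs = ys} m

allVecs-cartesian : ∀ m n → allVecs m (suc n) ≡ cartesianProductWith _∷ᵛ_ (allFin m) (allVecs m n)
allVecs-cartesian m n = concatMap≡cartesian (allFin m)
  where
  concatMap≡cartesian : ∀ is → concatMap (λ i → map (i ∷ᵛ_) (allVecs m n)) is ≡ cartesianProductWith _∷ᵛ_ is (allVecs m n)
  concatMap≡cartesian [] = refl
  concatMap≡cartesian (i ∷ is) = cong (map (i ∷ᵛ_) (allVecs m n) ++_) (concatMap≡cartesian is)

allVecs-complete : ∀ m n (v : Vec (Fin m) n) → v ∈ allVecs m n
allVecs-complete m zero []ᵛ = here refl
allVecs-complete m (suc n) (i ∷ᵛ v) rewrite allVecs-cartesian m n =
  ∈-cartesianProductWith⁺ _∷ᵛ_ (∈-allFin i) (allVecs-complete m n v)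

allVecs-unique : ∀ m n → Unique (allVecs m n)
allVecs-unique m zero = [] ∷ []
allVecs-unique m (suc n) rewrite allVecs-cartesian m n =
  UniqueP.cartesianProductWith⁺ _∷ᵛ_ ∷-injective (UniqueP.allFin⁺ m) (allVecs-unique m n)
  where
  ∷-injective : ∀ {i j : Fin m} {v w : Vec (Fin m) n} → (i ∷ᵛ v) ≡ (j ∷ᵛ w) → i ≡ j × v ≡ w
  ∷-injective refl = refl , refl

countVecs : (N : ℕ) → (Vec (Fin N) N → Bool) → ℕ
countVecs N P = count P (allVecs N N)

-- The index x as an element of Fin N (any element if x is out of range).
toFin : ∀ {N} → Fin N → ℕ → Fin N
toFin {suc n} _ x with x ℕ.<? suc n
... | yes x<N = F.fromℕ< x<N
... | no _ = F.zero

toℕ-toFin : ∀ {N} (i : Fin N) x → x < N → toℕ (toFin i x) ≡ x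
toℕ-toFin {suc n} i x x<N with x ℕ.<? suc n
... | yes x<N′ = FinP.toℕ-fromℕ< x<N′
... | no x≮N = ⊥-elim (x≮N x<N)

fromPartner : (N : ℕ) → (ℕ → ℕ) → Vec (Fin N) N
fromPartner N g = tabulate (λ i → toFin i (g (toℕ i)))

partner-fromPartner : ∀ N g x → x < N → g x < N → partner (fromPartner N g) x ≡ g x
partner-fromPartner N g x x<N gx<N = begin
  partner (fromPartner N g) x                    ≡⟨ cong (partner (fromPartner N g)) (sym (FinP.toℕ-fromℕ< x<N)) ⟩
  partner (fromPartner N g) (toℕ i)              ≡⟨ sym (partner-lookup (fromPartner N g) i) ⟩
  toℕ (Data.Vec.lookup (fromPartner N g) i)      ≡⟨ cong toℕ (VecP.lookup∘tabulate (λ i → toFin i (g (toℕ i))) i) ⟩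
  toℕ (toFin i (g (toℕ i)))                      ≡⟨ cong (λ k → toℕ (toFin i (g k))) (FinP.toℕ-fromℕ< x<N) ⟩
  toℕ (toFin i (g x))                            ≡⟨ toℕ-toFin i (g x) gx<N ⟩
  g x                                            ∎
  where
  open ≡-Reasoning
  i = F.fromℕ< x<N

partner-injective : ∀ {N k} (v w : Vec (Fin N) k) → (∀ x → x < k → partner v x ≡ partner w x) → v ≡ w
partner-injective []ᵛ []ᵛ _ = refl
partner-injective (i ∷ᵛ v) (j ∷ᵛ w) same =
  cong₂ _∷ᵛ_ (FinP.toℕ-injective (same 0 (s≤s z≤n))) (partner-injective v w (λ x x<k → same (suc x) (s≤s x<k)))

planar-cong : ∀ {N p f f′} → p ≤ N → (∀ x → x < N → f x ≡ f′ x) → Planar N p f → Planar N p f′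
planar-cong {N} {p} {f} {f′} p≤N f≗f′ G = record
  { bounded = λ x x<N → subst (_< N) (f≗f′ x x<N) (bounded x x<N)
  ; involutive = λ x x<N → trans (cong f′ (sym (f≗f′ x x<N))) (trans (sym (f≗f′ (f x) (bounded x x<N))) (involutive x x<N))
  ; no-fixpoint = λ x x<N e → no-fixpoint x x<N (trans (f≗f′ x x<N) e)
  ; adjacent = λ x x<N same → subst (λ k → k ≡ suc x ⊎ x ≡ suc k) (f≗f′ x x<N)
                                (adjacent x x<N (trans same (cong (_<ᵇ p) (sym (f≗f′ x x<N)))))
  ; monotone = λ x y x<y y<p p≤fx p≤fy →
      let y<N = ℕP.<-≤-trans y<p p≤N
          x<N = ℕP.<-trans x<y y<N
      in subst₂ _<_ (f≗f′ x x<N) (f≗f′ y y<N)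
           (monotone x y x<y y<p (subst (p ≤_) (sym (f≗f′ x x<N)) p≤fx) (subst (p ≤_) (sym (f≗f′ y y<N)) p≤fy))
  }
  where open Planar G

-- Removing two indices s ≠ t from a configuration of M points (pb on top) leaves one of
-- N points (ps on top).  ins embeds the small configuration into the big one, avoiding
-- s and t, with inverse del; it preserves lines, order and adjacency on a line.
record PairRemoval (M N pb ps s t : ℕ) : Set where
  field
    ins del    : ℕ → ℕ
    pb≤M       : pb ≤ M
    ps≤N       : ps ≤ N
    s<M        : s < M
    t<M        : t < M
    s≢t        : s ≢ t
    ins-<      : ∀ y → y < N → ins y < M
    ins-≢s     : ∀ y → y < N → ins y ≢ s
    ins-≢t     : ∀ y → y < N → ins y ≢ t
    del-ins    : ∀ y → y < N → del (ins y) ≡ y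
    del-<      : ∀ x → x < M → x ≢ s → x ≢ t → del x < N
    ins-del    : ∀ x → x < M → x ≢ s → x ≢ t → ins (del x) ≡ x
    ins-line   : ∀ y → y < N → (ins y <ᵇ pb) ≡ (y <ᵇ ps)
    ins-mono   : ∀ y y′ → y′ < N → y < y′ → ins y < ins y′
    ins-suc⁻   : ∀ y y′ → y < N → y′ < N → (y <ᵇ ps) ≡ (y′ <ᵇ ps) → ins y′ ≡ suc (ins y) → y′ ≡ suc y
    ins-suc    : ∀ y → suc y < N → (y <ᵇ ps) ≡ (suc y <ᵇ ps) → ins (suc y) ≡ suc (ins y)
    removed-adjacent : (s <ᵇ pb) ≡ (t <ᵇ pb) → t ≡ suc s
    removed-shape    : (s <ᵇ pb) ≡ (t <ᵇ pb) ⊎ (s ≡ 0 × t ≡ pb)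

module Removal {M N pb ps s t : ℕ} (R : PairRemoval M N pb ps s t) where
  open PairRemoval R

  ins-reflects-< : ∀ y y′ → y < N → y′ < N → ins y < ins y′ → y < y′
  ins-reflects-< y y′ y<N y′<N ins< with ℕP.<-cmp y y′
  ... | tri< y<y′ _ _ = y<y′
  ... | tri≈ _ y≡y′ _ = ⊥-elim (ℕP.<-irrefl (cong ins y≡y′) ins<)
  ... | tri> _ _ y′<y = ⊥-elim (ℕP.<-asym ins< (ins-mono y′ y y<N y′<y))

  restrict : (ℕ → ℕ) → ℕ → ℕ
  restrict f y = del (f (ins y))

  module Restrict (f : ℕ → ℕ) (G : Planar M pb f) (fs≡t : f s ≡ t) where
    open Planar G

    ft≡s : f t ≡ s
    ft≡s = trans (cong f (sym fs≡t)) (involutive s s<M)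

    module _ (y : ℕ) (y<N : y < N) where
      private
        x<M = ins-< y y<N

      partner-≢s : f (ins y) ≢ s
      partner-≢s e = ins-≢t y y<N (trans (sym (involutive (ins y) x<M)) (trans (cong f e) fs≡t))

      partner-≢t : f (ins y) ≢ t
      partner-≢t e = ins-≢s y y<N (trans (sym (involutive (ins y) x<M)) (trans (cong f e) ft≡s))

      restrict-< : restrict f y < N
      restrict-< = del-< (f (ins y)) (bounded (ins y) x<M) partner-≢s partner-≢t

      ins-restrict : ins (restrict f y) ≡ f (ins y)
      ins-restrict = ins-del (f (ins y)) (bounded (ins y) x<M) partner-≢s partner-≢t

    restrict-adjacent : ∀ y → y < N → (y <ᵇ ps) ≡ (restrict f y <ᵇ ps) → restrict f y ≡ suc y ⊎ y ≡ suc (restrict f y)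
    restrict-adjacent y y<N same
      with adjacent (ins y) (ins-< y y<N)
             (trans (ins-line y y<N) (trans same (trans (sym (ins-line (restrict f y) (restrict-< y y<N)))
                                                   (cong (_<ᵇ pb) (ins-restrict y y<N)))))
    ... | inj₁ e = inj₁ (ins-suc⁻ y (restrict f y) y<N (restrict-< y y<N) same (trans (ins-restrict y y<N) e))
    ... | inj₂ e = inj₂ (ins-suc⁻ (restrict f y) y (restrict-< y y<N) y<N (sym same)
                          (trans e (cong suc (sym (ins-restrict y y<N)))))

    restrict-monotone : ∀ y y′ → y < y′ → y′ < ps → ps ≤ restrict f y → ps ≤ restrict f y′ → restrict f y < restrict f y′
    restrict-monotone y y′ y<y′ y′<ps ps≤gy ps≤gy′ =
      ins-reflects-< (restrict f y) (restrict f y′) (restrict-< y y<N) (restrict-< y′ y′<N)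
        (subst₂ _<_ (sym (ins-restrict y y<N)) (sym (ins-restrict y′ y′<N))
          (monotone (ins y) (ins y′) (ins-mono y y′ y′<N y<y′)
            (<ᵇ-true⁻ (trans (ins-line y′ y′<N) (<ᵇ-true y′<ps)))
            (bottom y y<N ps≤gy) (bottom y′ y′<N ps≤gy′)))
      where
      y′<N = ℕP.<-≤-trans y′<ps ps≤N
      y<N = ℕP.<-trans y<y′ y′<N
      bottom : ∀ z → (z<N : z < N) → ps ≤ restrict f z → pb ≤ f (ins z)
      bottom z z<N ps≤gz = subst (pb ≤_) (ins-restrict z z<N)
        (<ᵇ-false⁻ (trans (ins-line (restrict f z) (restrict-< z z<N)) (<ᵇ-false ps≤gz)))

    restrict-planar : Planar N ps (restrict f)
    restrict-planar = record
      { bounded = restrict-<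
      ; involutive = λ y y<N → trans (cong (λ k → del (f k)) (ins-restrict y y<N))
                                (trans (cong del (involutive (ins y) (ins-< y y<N))) (del-ins y y<N))
      ; no-fixpoint = λ y y<N e → no-fixpoint (ins y) (ins-< y y<N) (trans (sym (ins-restrict y y<N)) (cong ins e))
      ; adjacent = restrict-adjacent
      ; monotone = restrict-monotone
      }

  removed-cross : (s <ᵇ pb) ≡ true → (t <ᵇ pb) ≡ false → s ≡ 0 × t ≡ pb
  removed-cross s-top t-bottom with removed-shape
  ... | inj₁ same = ⊥-elim (true≢false (trans (sym s-top) (trans same t-bottom)))
  ... | inj₂ first = first

  removed-not-reversed : (s <ᵇ pb) ≡ false → (t <ᵇ pb) ≡ true → ⊥
  removed-not-reversed s-bottom t-top with removed-shape
  ... | inj₁ same = true≢false (trans (sym t-top) (trans (sym same) s-bottom))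
  ... | inj₂ (_ , t≡pb) = ℕP.<-irrefl t≡pb (<ᵇ-true⁻ t-top)

  extendOn : (ℕ → ℕ) → Bool → Bool → ℕ → ℕ
  extendOn g true _ x = t
  extendOn g false true x = s
  extendOn g false false x = ins (g (del x))

  extend : (ℕ → ℕ) → ℕ → ℕ
  extend g x = extendOn g (x ≡ᵇ s) (x ≡ᵇ t) x

  extend-s : ∀ g → extend g s ≡ t
  extend-s g = cong (λ b → extendOn g b (s ≡ᵇ t) s) (≡ᵇ-true {s} refl)

  extend-t : ∀ g → extend g t ≡ s
  extend-t g = cong₂ (λ b b′ → extendOn g b b′ t) (≡ᵇ-false (λ e → s≢t (sym e))) (≡ᵇ-true {t} refl)

  extend-other : ∀ g x → x ≢ s → x ≢ t → extend g x ≡ ins (g (del x))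
  extend-other g x x≢s x≢t = cong₂ (λ b b′ → extendOn g b b′ x) (≡ᵇ-false x≢s) (≡ᵇ-false x≢t)

  module Extend (g : ℕ → ℕ) (G : Planar N ps g) where
    open Planar G

    module _ (x : ℕ) (x<M : x < M) (x≢s : x ≢ s) (x≢t : x ≢ t) where
      private
        y<N = del-< x x<M x≢s x≢t

      extend-ins : extend g x ≡ ins (g (del x))
      extend-ins = extend-other g x x≢s x≢t

      extend-< : extend g x < M
      extend-< = subst (_< M) (sym extend-ins) (ins-< (g (del x)) (bounded (del x) y<N))

      extend-≢s : extend g x ≢ s
      extend-≢s e = ins-≢s (g (del x)) (bounded (del x) y<N) (trans (sym extend-ins) e)

      extend-≢t : extend g x ≢ t
      extend-≢t e = ins-≢t (g (del x)) (bounded (del x) y<N) (trans (sym extend-ins) e)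

      extend-adjacent-other : (x <ᵇ pb) ≡ (extend g x <ᵇ pb) → extend g x ≡ suc x ⊎ x ≡ suc (extend g x)
      extend-adjacent-other same = transport (adjacent y y<N same′)
        where
        y = del x
        ins-y≡x = ins-del x x<M x≢s x≢t
        same′ : (y <ᵇ ps) ≡ (g y <ᵇ ps)
        same′ = trans (sym (ins-line y y<N))
                 (trans (cong (_<ᵇ pb) ins-y≡x)
                   (trans same (trans (cong (_<ᵇ pb) extend-ins) (ins-line (g y) (bounded y y<N)))))
        transport : g y ≡ suc y ⊎ y ≡ suc (g y) → extend g x ≡ suc x ⊎ x ≡ suc (extend g x)
        transport (inj₁ gy≡1+y) = inj₁ (trans extend-ins (trans (cong ins gy≡1+y)
          (trans (ins-suc y (subst (_< N) gy≡1+y (bounded y y<N)) (trans same′ (cong (_<ᵇ ps) gy≡1+y)))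
                 (cong suc ins-y≡x))))
        transport (inj₂ y≡1+gy) = inj₂ (trans (sym ins-y≡x) (trans (cong ins y≡1+gy)
          (trans (ins-suc (g y) (subst (_< N) y≡1+gy y<N) (trans (sym same′) (cong (_<ᵇ ps) y≡1+gy)))
                 (cong suc (sym extend-ins)))))

    extend-bounded : ∀ x → x < M → extend g x < M
    extend-bounded x x<M with x ℕ.≟ s | x ℕ.≟ t
    ... | yes refl | _ = subst (_< M) (sym (extend-s g)) t<M
    ... | no _ | yes refl = subst (_< M) (sym (extend-t g)) s<M
    ... | no x≢s | no x≢t = extend-< x x<M x≢s x≢t

    extend-involutive : ∀ x → x < M → extend g (extend g x) ≡ x
    extend-involutive x x<M with x ℕ.≟ s | x ℕ.≟ t
    ... | yes refl | _ = trans (cong (extend g) (extend-s g)) (extend-t g)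
    ... | no _ | yes refl = trans (cong (extend g) (extend-t g)) (extend-s g)
    ... | no x≢s | no x≢t = begin
      extend g (extend g x)          ≡⟨ extend-other g _ (extend-≢s x x<M x≢s x≢t) (extend-≢t x x<M x≢s x≢t) ⟩
      ins (g (del (extend g x)))     ≡⟨ cong (λ k → ins (g (del k))) (extend-ins x x<M x≢s x≢t) ⟩
      ins (g (del (ins (g y))))      ≡⟨ cong (λ k → ins (g k)) (del-ins (g y) (bounded y y<N)) ⟩
      ins (g (g y))                  ≡⟨ cong ins (involutive y y<N) ⟩
      ins y                          ≡⟨ ins-del x x<M x≢s x≢t ⟩
      x                              ∎
      where
      open ≡-Reasoning
      y = del x
      y<N = del-< x x<M x≢s x≢t

    extend-no-fixpoint : ∀ x → x < M → extend g x ≢ x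
    extend-no-fixpoint x x<M with x ℕ.≟ s | x ℕ.≟ t
    ... | yes refl | _ = λ e → s≢t (sym (trans (sym (extend-s g)) e))
    ... | no _ | yes refl = λ e → s≢t (trans (sym (extend-t g)) e)
    ... | no x≢s | no x≢t = λ e → no-fixpoint (del x) (del-< x x<M x≢s x≢t)
        (trans (sym (del-ins _ (bounded _ (del-< x x<M x≢s x≢t))))
               (trans (cong del (sym (extend-ins x x<M x≢s x≢t))) (cong del e)))

    extend-adjacent : ∀ x → x < M → (x <ᵇ pb) ≡ (extend g x <ᵇ pb) → extend g x ≡ suc x ⊎ x ≡ suc (extend g x)
    extend-adjacent x x<M same with x ℕ.≟ s | x ℕ.≟ t
    ... | yes refl | _ = inj₁ (trans (extend-s g) (removed-adjacent (trans same (cong (_<ᵇ pb) (extend-s g)))))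
    ... | no _ | yes refl = inj₂ (trans (removed-adjacent (sym (trans same (cong (_<ᵇ pb) (extend-t g)))))
                                        (cong suc (sym (extend-t g))))
    ... | no x≢s | no x≢t = extend-adjacent-other x x<M x≢s x≢t same

    extend-monotone : ∀ x z → x < z → z < pb → pb ≤ extend g x → pb ≤ extend g z → extend g x < extend g z
    extend-monotone x z x<z z<pb pb≤Fx pb≤Fz with x ℕ.≟ s | x ℕ.≟ t | z ℕ.≟ s | z ℕ.≟ t
    ... | yes refl | _ | _ | _ =
      let s≡0 , t≡pb = removed-cross (<ᵇ-true (ℕP.<-trans x<z z<pb)) (<ᵇ-false (subst (pb ≤_) (extend-s g) pb≤Fx))
          z≢s : z ≢ s
          z≢s e = ℕP.<-irrefl (sym e) x<z
          z≢t : z ≢ t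
          z≢t e = ℕP.<-irrefl (trans e t≡pb) z<pb
      in subst (_< extend g z) (sym (extend-s g))
           (ℕP.≤∧≢⇒< (subst (_≤ extend g z) (sym t≡pb) pb≤Fz)
                     (λ e → extend-≢t z (ℕP.<-≤-trans z<pb pb≤M) z≢s z≢t (sym e)))
    ... | no _ | yes refl | _ | _ =
      ⊥-elim (removed-not-reversed (<ᵇ-false (subst (pb ≤_) (extend-t g) pb≤Fx)) (<ᵇ-true (ℕP.<-trans x<z z<pb)))
    ... | no _ | no _ | yes refl | _ =
      let s≡0 , _ = removed-cross (<ᵇ-true z<pb) (<ᵇ-false (subst (pb ≤_) (extend-s g) pb≤Fz))
      in ⊥-elim (ℕP.n≮0 (subst (x <_) s≡0 x<z))
    ... | no _ | no _ | no _ | yes refl =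
      ⊥-elim (removed-not-reversed (<ᵇ-false (subst (pb ≤_) (extend-t g) pb≤Fz)) (<ᵇ-true z<pb))
    ... | no x≢s | no x≢t | no z≢s | no z≢t =
      subst₂ _<_ (sym (extend-ins x x<M x≢s x≢t)) (sym (extend-ins z z<M z≢s z≢t))
        (ins-mono (g x′) (g z′) (bounded z′ z′<N)
          (monotone x′ z′ x′<z′ z′<ps (bottom x x<M x≢s x≢t pb≤Fx) (bottom z z<M z≢s z≢t pb≤Fz)))
      where
      z<M = ℕP.<-≤-trans z<pb pb≤M
      x<M = ℕP.<-trans x<z z<M
      x′ = del x
      z′ = del z
      z′<N = del-< z z<M z≢s z≢t
      x′<z′ : x′ < z′
      x′<z′ = ins-reflects-< x′ z′ (del-< x x<M x≢s x≢t) z′<N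
        (subst₂ _<_ (sym (ins-del x x<M x≢s x≢t)) (sym (ins-del z z<M z≢s z≢t)) x<z)
      z′<ps : z′ < ps
      z′<ps = <ᵇ-true⁻ (trans (sym (ins-line z′ z′<N)) (trans (cong (_<ᵇ pb) (ins-del z z<M z≢s z≢t)) (<ᵇ-true z<pb)))
      bottom : ∀ w (w<M : w < M) (w≢s : w ≢ s) (w≢t : w ≢ t) → pb ≤ extend g w → ps ≤ g (del w)
      bottom w w<M w≢s w≢t pb≤Fw = <ᵇ-false⁻ (trans (sym (ins-line (g (del w)) (bounded (del w) (del-< w w<M w≢s w≢t))))
                                     (<ᵇ-false (subst (pb ≤_) (extend-ins w w<M w≢s w≢t) pb≤Fw)))

    extend-planar : Planar M pb (extend g)
    extend-planar = record
      { bounded = extend-bounded ; involutive = extend-involutive ; no-fixpoint = extend-no-fixpoint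
      ; adjacent = extend-adjacent ; monotone = extend-monotone }

  shrink : Vec (Fin M) M → Vec (Fin N) N
  shrink v = fromPartner N (restrict (partner v))

  grow : Vec (Fin N) N → Vec (Fin M) M
  grow w = fromPartner M (extend (partner w))

  module _ (v : Vec (Fin M) M) (G : Planar M pb (partner v)) (vs≡t : partner v s ≡ t) where
    open Restrict (partner v) G vs≡t

    partner-shrink : ∀ y → y < N → partner (shrink v) y ≡ restrict (partner v) y
    partner-shrink y y<N = partner-fromPartner N _ y y<N (restrict-< y y<N)

    shrink-planar : Planar N ps (partner (shrink v))
    shrink-planar = planar-cong ps≤N (λ y y<N → sym (partner-shrink y y<N)) restrict-planar

    grow-shrink : grow (shrink v) ≡ v
    grow-shrink = partner-injective _ _ same
      where
      open Extend (partner (shrink v)) shrink-planar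
      same : ∀ x → x < M → partner (grow (shrink v)) x ≡ partner v x
      same x x<M = trans (partner-fromPartner M _ x x<M (extend-bounded x x<M)) (by-cases (x ℕ.≟ s) (x ℕ.≟ t))
        where
        by-cases : Dec (x ≡ s) → Dec (x ≡ t) → extend (partner (shrink v)) x ≡ partner v x
        by-cases (yes refl) _ = trans (extend-s _) (sym vs≡t)
        by-cases (no _) (yes refl) = trans (extend-t _) (sym ft≡s)
        by-cases (no x≢s) (no x≢t) = begin
          extend (partner (shrink v)) x            ≡⟨ extend-other _ x x≢s x≢t ⟩
          ins (partner (shrink v) (del x))         ≡⟨ cong ins (partner-shrink (del x) (del-< x x<M x≢s x≢t)) ⟩
          ins (restrict (partner v) (del x))       ≡⟨ ins-restrict (del x) (del-< x x<M x≢s x≢t) ⟩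
          partner v (ins (del x))                  ≡⟨ cong (partner v) (ins-del x x<M x≢s x≢t) ⟩
          partner v x                              ∎
          where open ≡-Reasoning

  module _ (w : Vec (Fin N) N) (G : Planar N ps (partner w)) where
    open Extend (partner w) G
    open Planar G

    partner-grow : ∀ x → x < M → partner (grow w) x ≡ extend (partner w) x
    partner-grow x x<M = partner-fromPartner M _ x x<M (extend-bounded x x<M)

    grow-planar : Planar M pb (partner (grow w))
    grow-planar = planar-cong pb≤M (λ x x<M → sym (partner-grow x x<M)) extend-planar

    grow-pairs-s-t : partner (grow w) s ≡ t
    grow-pairs-s-t = trans (partner-grow s s<M) (extend-s _)

    shrink-grow : shrink (grow w) ≡ w
    shrink-grow = partner-injective _ _ same
      where
      same : ∀ y → y < N → partner (shrink (grow w)) y ≡ partner w y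
      same y y<N = trans (partner-fromPartner N _ y y<N (subst (_< N) (sym restricted) (bounded y y<N))) restricted
        where
        restricted : restrict (partner (grow w)) y ≡ partner w y
        restricted = begin
          del (partner (grow w) (ins y))           ≡⟨ cong del (partner-grow (ins y) (ins-< y y<N)) ⟩
          del (extend (partner w) (ins y))         ≡⟨ cong del (extend-other _ (ins y) (ins-≢s y y<N) (ins-≢t y y<N)) ⟩
          del (ins (partner w (del (ins y))))      ≡⟨ del-ins _ (bounded (del (ins y)) (subst (_< N) (sym (del-ins y y<N)) y<N)) ⟩
          partner w (del (ins y))                  ≡⟨ cong (partner w) (del-ins y y<N) ⟩
          partner w y                              ∎
          where open ≡-Reasoning

  count-removal : (Vb : Vec (Fin M) M → Bool) (Vs : Vec (Fin N) N → Bool) →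
    (∀ v → Vb v ≡ true → Planar M pb (partner v)) → (∀ v → Planar M pb (partner v) → Vb v ≡ true) →
    (∀ w → Vs w ≡ true → Planar N ps (partner w)) → (∀ w → Planar N ps (partner w) → Vs w ≡ true) →
    (X : Vec (Fin M) M → Bool) (Y : Vec (Fin N) N → Bool) →
    (∀ v → Planar M pb (partner v) → partner v s ≡ t → X v ≡ Y (shrink v)) →
    countVecs M (λ v → Vb v ∧ ((partner v s ≡ᵇ t) ∧ X v)) ≡ countVecs N (λ w → Vs w ∧ Y w)
  count-removal Vb Vs Vb⇒planar planar⇒Vb Vs⇒planar planar⇒Vs X Y X≡Y =
    count-bijection (λ v → Vb v ∧ ((partner v s ≡ᵇ t) ∧ X v)) (λ w → Vs w ∧ Y w) (allVecs M M) (allVecs N N)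
      (allVecs-unique M M) (allVecs-unique N N) (allVecs-complete M M) (allVecs-complete N N)
      shrink grow to from grow∘shrink shrink∘grow
    where
    split3 : ∀ {a b c} → (a ∧ (b ∧ c)) ≡ true → a ≡ true × b ≡ true × c ≡ true
    split3 {true} {true} {true} _ = refl , refl , refl
    split2 : ∀ {a b} → (a ∧ b) ≡ true → a ≡ true × b ≡ true
    split2 {true} {true} _ = refl , refl
    and3 : ∀ {a b c} → a ≡ true → b ≡ true → c ≡ true → (a ∧ (b ∧ c)) ≡ true
    and3 refl refl refl = refl
    and2 : ∀ {a b} → a ≡ true → b ≡ true → (a ∧ b) ≡ true
    and2 refl refl = refl
    to : ∀ v → (Vb v ∧ ((partner v s ≡ᵇ t) ∧ X v)) ≡ true → (Vs (shrink v) ∧ Y (shrink v)) ≡ true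
    to v h with split3 h
    ... | valid , pairs , Xv = and2 (planar⇒Vs _ (shrink-planar v G (≡ᵇ-true⁻ pairs)))
                                 (trans (sym (X≡Y v G (≡ᵇ-true⁻ pairs))) Xv)
      where G = Vb⇒planar v valid
    from : ∀ w → (Vs w ∧ Y w) ≡ true → (Vb (grow w) ∧ ((partner (grow w) s ≡ᵇ t) ∧ X (grow w))) ≡ true
    from w h with split2 h
    ... | valid , Yw = and3 (planar⇒Vb _ (grow-planar w G)) (≡ᵇ-true (grow-pairs-s-t w G))
                         (trans (X≡Y (grow w) (grow-planar w G) (grow-pairs-s-t w G)) (trans (cong Y (shrink-grow w G)) Yw))
      where G = Vs⇒planar w valid
    grow∘shrink : ∀ v → (Vb v ∧ ((partner v s ≡ᵇ t) ∧ X v)) ≡ true → grow (shrink v) ≡ v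
    grow∘shrink v h with split3 h
    ... | valid , pairs , _ = grow-shrink v (Vb⇒planar v valid) (≡ᵇ-true⁻ pairs)
    shrink∘grow : ∀ w → (Vs w ∧ Y w) ≡ true → shrink (grow w) ≡ w
    shrink∘grow w h with split2 h
    ... | valid , _ = shrink-grow w (Vs⇒planar w valid)

count-valid-removal : ∀ {pb qb ps qs s t} (R : PairRemoval (pb ℕ.+ qb) (ps ℕ.+ qs) pb ps s t) →
  (X : Vec (Fin (pb ℕ.+ qb)) (pb ℕ.+ qb) → Bool) (Y : Vec (Fin (ps ℕ.+ qs)) (ps ℕ.+ qs) → Bool) →
  (∀ v → Planar (pb ℕ.+ qb) pb (partner v) → partner v s ≡ t → X v ≡ Y (Removal.shrink R v)) →
  countVecs (pb ℕ.+ qb) (λ v → validMatching pb qb v ∧ ((partner v s ≡ᵇ t) ∧ X v))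
  ≡ countVecs (ps ℕ.+ qs) (λ w → validMatching ps qs w ∧ Y w)
count-valid-removal {pb} {qb} {ps} {qs} R = Removal.count-removal R (validMatching pb qb) (validMatching ps qs)
  (valid⇒planar pb qb) (planar⇒valid pb qb) (valid⇒planar ps qs) (planar⇒valid ps qs)

-- Index shifts for the removal of K, K+1 (the boolean says whether the index is below K).
insB : Bool → ℕ → ℕ
insB true y = y
insB false y = suc (suc y)

delB : Bool → ℕ → ℕ
delB true x = x
delB false x = x ∸ 2

StartOfLine : ℕ → ℕ → ℕ → Set
StartOfLine K pb ps = (pb ≡ K × ps ≡ K) ⊎ (K ≡ 0 × pb ≡ suc (suc ps))

module NeighbourRemoval (K N M pb ps : ℕ) (M≡2+N : M ≡ suc (suc N)) (K≤N : K ≤ N) (ps≤N : ps ≤ N)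
  (position : StartOfLine K pb ps) where
  ins : ℕ → ℕ
  ins y = insB (y <ᵇ K) y
  del : ℕ → ℕ
  del x = delB (x <ᵇ K) x

  ins-low : ∀ {y} → y < K → ins y ≡ y
  ins-low {y} h = cong (λ b → insB b y) (<ᵇ-true h)
  ins-high : ∀ {y} → K ≤ y → ins y ≡ suc (suc y)
  ins-high {y} h = cong (λ b → insB b y) (<ᵇ-false h)
  del-low : ∀ {x} → x < K → del x ≡ x
  del-low {x} h = cong (λ b → delB b x) (<ᵇ-true h)
  del-high : ∀ {x} → K ≤ x → del x ≡ x ∸ 2
  del-high {x} h = cong (λ b → delB b x) (<ᵇ-false h)

  s<M : K < M
  s<M = subst (K <_) (sym M≡2+N) (s≤s (ℕP.m≤n⇒m≤1+n K≤N))
  t<M : suc K < M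
  t<M = subst (suc K <_) (sym M≡2+N) (s≤s (s≤s K≤N))
  s≢t : K ≢ suc K
  s≢t e = ℕP.<-irrefl e (ℕP.n<1+n K)

  split : ∀ y → y < K ⊎ K ≤ y
  split y with y ℕ.<? K
  ... | yes h = inj₁ h
  ... | no h = inj₂ (ℕP.≮⇒≥ h)

  N<M : ∀ {y} → y < N → y < M
  N<M h = subst (_ <_) (sym M≡2+N) (ℕP.m<n⇒m<1+n (ℕP.m<n⇒m<1+n h))

  by-position : ∀ {A : Set} → ((pb ≡ K × ps ≡ K) → A) → ((K ≡ 0 × pb ≡ suc (suc ps)) → A) → A
  by-position f g = [ f , g ]′ position

  pb≤M : pb ≤ M
  pb≤M = by-position (λ { (e , _) → subst (_≤ M) (sym e) (ℕP.<⇒≤ s<M) })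
               (λ { (_ , e) → subst₂ _≤_ (sym e) (sym M≡2+N) (s≤s (s≤s ps≤N)) })

  ins-< : ∀ y → y < N → ins y < M
  ins-< y y<N with split y
  ... | inj₁ h = subst (_< M) (sym (ins-low h)) (N<M y<N)
  ... | inj₂ h = subst₂ _<_ (sym (ins-high h)) (sym M≡2+N) (s≤s (s≤s y<N))

  ins-≢s : ∀ y → y < N → ins y ≢ K
  ins-≢s y y<N e with split y
  ... | inj₁ h = ℕP.<-irrefl (trans (sym (ins-low h)) e) h
  ... | inj₂ h = ℕP.<-irrefl (sym (trans (sym (ins-high h)) e)) (ℕP.<-trans (s≤s h) (ℕP.n<1+n _))

  ins-≢t : ∀ y → y < N → ins y ≢ suc K
  ins-≢t y y<N e with split y
  ... | inj₁ h = ℕP.<-irrefl (trans (sym (ins-low h)) e) (ℕP.<-trans h (ℕP.n<1+n K))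
  ... | inj₂ h = ℕP.<-irrefl (sym (trans (sym (ins-high h)) e)) (s≤s (s≤s h))

  del-ins : ∀ y → y < N → del (ins y) ≡ y
  del-ins y y<N with split y
  ... | inj₁ h = trans (cong del (ins-low h)) (del-low h)
  ... | inj₂ h = trans (cong del (ins-high h)) (del-high (ℕP.m≤n⇒m≤1+n (ℕP.m≤n⇒m≤1+n h)))

  beyond : ∀ {x} → K ≤ x → x ≢ K → x ≢ suc K → suc (suc K) ≤ x
  beyond {x} h ≢s ≢t = ℕP.≤∧≢⇒< (ℕP.≤∧≢⇒< h (λ e → ≢s (sym e))) (λ e → ≢t (sym e))

  del-< : ∀ x → x < M → x ≢ K → x ≢ suc K → del x < N
  del-< x x<M ≢s ≢t with split x
  ... | inj₁ h = subst (_< N) (sym (del-low h)) (ℕP.<-≤-trans h K≤N)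
  ... | inj₂ h with beyond h ≢s ≢t | subst (x <_) M≡2+N x<M
  ...   | s≤s (s≤s _) | s≤s (s≤s l) = subst (_< N) (sym (del-high h)) l

  ins-del : ∀ x → x < M → x ≢ K → x ≢ suc K → ins (del x) ≡ x
  ins-del x x<M ≢s ≢t with split x
  ... | inj₁ h = trans (cong ins (del-low h)) (ins-low h)
  ... | inj₂ h with beyond h ≢s ≢t
  ...   | s≤s (s≤s l) = trans (cong ins (del-high h)) (ins-high l)

  ins-line : ∀ y → y < N → (ins y <ᵇ pb) ≡ (y <ᵇ ps)
  ins-line y y<N with split y
  ... | inj₁ h = by-position (λ { (e1 , e2) → trans (cong (_<ᵇ pb) (ins-low h)) (trans (cong (y <ᵇ_) e1) (cong (y <ᵇ_) (sym e2))) })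
                        (λ { (e0 , _) → ⊥-elim (ℕP.n≮0 (subst (y <_) e0 h)) })
  ... | inj₂ h = by-position (λ { (e1 , e2) → trans (cong (_<ᵇ pb) (ins-high h))
        (trans (<ᵇ-false (subst (_≤ suc (suc y)) (sym e1) (ℕP.m≤n⇒m≤1+n (ℕP.m≤n⇒m≤1+n h)))) (sym (<ᵇ-false (subst (_≤ y) (sym e2) h)))) })
                        (λ { (_ , e) → trans (cong (_<ᵇ pb) (ins-high h)) (cong (suc (suc y) <ᵇ_) e) })

  ins-mono : ∀ y y′ → y′ < N → y < y′ → ins y < ins y′
  ins-mono y y′ y′<N y<y′ with split y | split y′
  ... | inj₁ h | inj₁ h′ = subst₂ _<_ (sym (ins-low h)) (sym (ins-low h′)) y<y′
  ... | inj₁ h | inj₂ h′ = subst₂ _<_ (sym (ins-low h)) (sym (ins-high h′)) (ℕP.<-trans y<y′ (ℕP.<-trans (ℕP.n<1+n _) (ℕP.n<1+n _)))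
  ... | inj₂ h | inj₁ h′ = ⊥-elim (ℕP.<-irrefl refl (ℕP.<-trans h′ (ℕP.≤-<-trans h y<y′)))
  ... | inj₂ h | inj₂ h′ = subst₂ _<_ (sym (ins-high h)) (sym (ins-high h′)) (s≤s (s≤s y<y′))

  ins-suc⁻ : ∀ y y′ → y < N → y′ < N → (y <ᵇ ps) ≡ (y′ <ᵇ ps) → ins y′ ≡ suc (ins y) → y′ ≡ suc y
  ins-suc⁻ y y′ y<N y′<N _ e with split y | split y′
  ... | inj₁ h | inj₁ h′ = trans (sym (ins-low h′)) (trans e (cong suc (ins-low h)))
  ... | inj₁ h | inj₂ h′ = ⊥-elim (ℕP.<-irrefl refl (ℕP.<-≤-trans h (ℕP.≤-trans h′ (ℕP.<⇒≤ (subst (y′ <_) q (ℕP.n<1+n y′))))))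
    where
    q : suc y′ ≡ y
    q = ℕP.suc-injective (trans (sym (ins-high h′)) (trans e (cong suc (ins-low h))))
  ... | inj₂ h | inj₁ h′ = ⊥-elim (ℕP.<-irrefl refl (ℕP.<-≤-trans h′ (ℕP.≤-trans h (ℕP.<⇒≤ (subst (y <_) (sym q) (ℕP.<-trans (ℕP.n<1+n y) (ℕP.<-trans (ℕP.n<1+n _) (ℕP.n<1+n _))))))))
    where
    q : y′ ≡ suc (suc (suc y))
    q = trans (sym (ins-low h′)) (trans e (cong suc (ins-high h)))
  ... | inj₂ h | inj₂ h′ = ℕP.suc-injective (ℕP.suc-injective (trans (sym (ins-high h′)) (trans e (cong suc (ins-high h)))))

  line-change-at-K : ∀ y → y < K → K ≤ suc y → (y <ᵇ ps) ≡ (suc y <ᵇ ps) → ⊥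
  line-change-at-K y h h′ e = by-position (λ { (_ , e2) → true≢false (trans (sym (trans (cong (y <ᵇ_) e2) (<ᵇ-true h))) (trans e (trans (cong (suc y <ᵇ_) e2) (<ᵇ-false h′)))) })
                         (λ { (e0 , _) → ℕP.n≮0 (subst (y <_) e0 h) })

  ins-suc : ∀ y → suc y < N → (y <ᵇ ps) ≡ (suc y <ᵇ ps) → ins (suc y) ≡ suc (ins y)
  ins-suc y y<N e with split y | split (suc y)
  ... | inj₁ h | inj₁ h′ = trans (ins-low h′) (cong suc (sym (ins-low h)))
  ... | inj₁ h | inj₂ h′ = ⊥-elim (line-change-at-K y h h′ e)
  ... | inj₂ h | inj₁ h′ = ⊥-elim (ℕP.<-irrefl refl (ℕP.<-≤-trans h′ (ℕP.m≤n⇒m≤1+n h)))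
  ... | inj₂ h | inj₂ h′ = trans (ins-high h′) (cong suc (sym (ins-high h)))

  removed-shape : (K <ᵇ pb) ≡ (suc K <ᵇ pb) ⊎ (K ≡ 0 × suc K ≡ pb)
  removed-shape = by-position (λ { (e1 , _) → inj₁ (trans (<ᵇ-false (subst (_≤ K) (sym e1) ℕP.≤-refl)) (sym (<ᵇ-false (subst (_≤ suc K) (sym e1) (ℕP.n≤1+n K))))) })
              (λ { (e0 , e) → inj₁ (trans (cong (_<ᵇ pb) e0) (trans (cong (0 <ᵇ_) e) (trans refl (sym (trans (cong (λ k → suc k <ᵇ pb) e0) (cong (1 <ᵇ_) e)))))) })

  removal : PairRemoval M N pb ps K (suc K)
  removal = record
    { ins = ins ; del = del ; pb≤M = pb≤M ; ps≤N = ps≤N ; s<M = s<M ; t<M = t<M ; s≢t = s≢t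
    ; ins-< = ins-< ; ins-≢s = ins-≢s ; ins-≢t = ins-≢t ; del-ins = del-ins ; del-< = del-< ; ins-del = ins-del
    ; ins-line = ins-line ; ins-mono = ins-mono ; ins-suc⁻ = ins-suc⁻ ; ins-suc = ins-suc
    ; removed-adjacent = λ _ → refl ; removed-shape = removed-shape }

-- Index shifts for the removal of 0 and P+1 (the boolean says whether the index is below P+1).
insA : Bool → ℕ → ℕ
insA true y = suc y
insA false y = suc (suc y)

delA : Bool → ℕ → ℕ
delA true x = x ∸ 1
delA false x = x ∸ 2

module FirstPointsRemoval (P N M : ℕ) (M≡2+N : M ≡ suc (suc N)) (P≤N : P ≤ N) where
  ins : ℕ → ℕ
  ins y = insA (y <ᵇ P) y
  del : ℕ → ℕ
  del x = delA (x <ᵇ suc P) x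

  ins-low : ∀ {y} → y < P → ins y ≡ suc y
  ins-low {y} h = cong (λ b → insA b y) (<ᵇ-true h)
  ins-high : ∀ {y} → P ≤ y → ins y ≡ suc (suc y)
  ins-high {y} h = cong (λ b → insA b y) (<ᵇ-false h)
  del-low : ∀ {x} → x < suc P → del x ≡ x ∸ 1
  del-low {x} h = cong (λ b → delA b x) (<ᵇ-true h)
  del-high : ∀ {x} → suc P ≤ x → del x ≡ x ∸ 2
  del-high {x} h = cong (λ b → delA b x) (<ᵇ-false h)

  split : ∀ y → y < P ⊎ P ≤ y
  split y with y ℕ.<? P
  ... | yes h = inj₁ h
  ... | no h = inj₂ (ℕP.≮⇒≥ h)

  pb≤M : suc P ≤ M
  pb≤M = subst (suc P ≤_) (sym M≡2+N) (s≤s (ℕP.m≤n⇒m≤1+n P≤N))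
  s<M : 0 < M
  s<M = subst (0 <_) (sym M≡2+N) (s≤s z≤n)
  t<M : suc P < M
  t<M = subst (suc P <_) (sym M≡2+N) (s≤s (s≤s P≤N))
  s≢t : 0 ≢ suc P
  s≢t ()

  ins-< : ∀ y → y < N → ins y < M
  ins-< y y<N with split y
  ... | inj₁ h = subst₂ _<_ (sym (ins-low h)) (sym M≡2+N) (s≤s (ℕP.m<n⇒m<1+n y<N))
  ... | inj₂ h = subst₂ _<_ (sym (ins-high h)) (sym M≡2+N) (s≤s (s≤s y<N))

  ins-≢s : ∀ y → y < N → ins y ≢ 0
  ins-≢s y y<N e with split y
  ... | inj₁ h = ℕP.1+n≢0 (trans (sym (ins-low h)) e)
  ... | inj₂ h = ℕP.1+n≢0 (trans (sym (ins-high h)) e)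

  ins-≢t : ∀ y → y < N → ins y ≢ suc P
  ins-≢t y y<N e with split y
  ... | inj₁ h = ℕP.<-irrefl (ℕP.suc-injective (trans (sym (ins-low h)) e)) h
  ... | inj₂ h = ℕP.<-irrefl (sym (trans (sym (ins-high h)) e)) (s≤s (s≤s h))

  del-ins : ∀ y → y < N → del (ins y) ≡ y
  del-ins y y<N with split y
  ... | inj₁ h = trans (cong del (ins-low h)) (del-low (s≤s h))
  ... | inj₂ h = trans (cong del (ins-high h)) (del-high (s≤s (ℕP.m≤n⇒m≤1+n h)))

  del-< : ∀ x → x < M → x ≢ 0 → x ≢ suc P → del x < N
  del-< zero x<M ≢s ≢t = ⊥-elim (≢s refl)
  del-< (suc x) x<M ≢s ≢t with split x
  ... | inj₁ h = subst (_< N) (sym (del-low (s≤s h))) (ℕP.<-≤-trans h P≤N)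
  ... | inj₂ h with ℕP.≤∧≢⇒< h (λ e → ≢t (cong suc (sym e))) | subst (suc x <_) M≡2+N x<M
  ...   | s≤s _ | s≤s (s≤s l) = subst (_< N) (sym (del-high (s≤s h))) l

  ins-del : ∀ x → x < M → x ≢ 0 → x ≢ suc P → ins (del x) ≡ x
  ins-del zero x<M ≢s ≢t = ⊥-elim (≢s refl)
  ins-del (suc x) x<M ≢s ≢t with split x
  ... | inj₁ h = trans (cong ins (del-low (s≤s h))) (ins-low h)
  ... | inj₂ h with ℕP.≤∧≢⇒< h (λ e → ≢t (cong suc (sym e)))
  ...   | s≤s l = trans (cong ins (del-high (s≤s h))) (ins-high l)

  ins-line : ∀ y → y < N → (ins y <ᵇ suc P) ≡ (y <ᵇ P)
  ins-line y y<N with split y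
  ... | inj₁ h = cong (_<ᵇ suc P) (ins-low h)
  ... | inj₂ h = trans (cong (_<ᵇ suc P) (ins-high h)) (trans (<ᵇ-false (s≤s (ℕP.m≤n⇒m≤1+n h))) (sym (<ᵇ-false h)))

  ins-mono : ∀ y y′ → y′ < N → y < y′ → ins y < ins y′
  ins-mono y y′ y′<N y<y′ with split y | split y′
  ... | inj₁ h | inj₁ h′ = subst₂ _<_ (sym (ins-low h)) (sym (ins-low h′)) (s≤s y<y′)
  ... | inj₁ h | inj₂ h′ = subst₂ _<_ (sym (ins-low h)) (sym (ins-high h′)) (s≤s (ℕP.m<n⇒m<1+n y<y′))
  ... | inj₂ h | inj₁ h′ = ⊥-elim (ℕP.<-irrefl refl (ℕP.<-trans h′ (ℕP.≤-<-trans h y<y′)))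
  ... | inj₂ h | inj₂ h′ = subst₂ _<_ (sym (ins-high h)) (sym (ins-high h′)) (s≤s (s≤s y<y′))

  ins-suc⁻ : ∀ y y′ → y < N → y′ < N → (y <ᵇ P) ≡ (y′ <ᵇ P) → ins y′ ≡ suc (ins y) → y′ ≡ suc y
  ins-suc⁻ y y′ y<N y′<N _ e with split y | split y′
  ... | inj₁ h | inj₁ h′ = ℕP.suc-injective (trans (sym (ins-low h′)) (trans e (cong suc (ins-low h))))
  ... | inj₁ h | inj₂ h′ = ⊥-elim (ℕP.<-irrefl refl (ℕP.<-≤-trans h (subst (P ≤_) q h′)))
    where
    q : y′ ≡ y
    q = ℕP.suc-injective (ℕP.suc-injective (trans (sym (ins-high h′)) (trans e (cong suc (ins-low h)))))
  ... | inj₂ h | inj₁ h′ = ⊥-elim (ℕP.<-irrefl refl (ℕP.<-≤-trans h′ (ℕP.≤-trans h (ℕP.<⇒≤ (subst (y <_) (sym q) (ℕP.<-trans (ℕP.n<1+n y) (ℕP.n<1+n _)))))))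
    where
    q : y′ ≡ suc (suc y)
    q = ℕP.suc-injective (trans (sym (ins-low h′)) (trans e (cong suc (ins-high h))))
  ... | inj₂ h | inj₂ h′ = ℕP.suc-injective (ℕP.suc-injective (trans (sym (ins-high h′)) (trans e (cong suc (ins-high h)))))

  ins-suc : ∀ y → suc y < N → (y <ᵇ P) ≡ (suc y <ᵇ P) → ins (suc y) ≡ suc (ins y)
  ins-suc y y<N e with split y | split (suc y)
  ... | inj₁ h | inj₁ h′ = trans (ins-low h′) (cong suc (sym (ins-low h)))
  ... | inj₁ h | inj₂ h′ = ⊥-elim (true≢false (trans (sym (<ᵇ-true h)) (trans e (<ᵇ-false h′))))
  ... | inj₂ h | inj₁ h′ = ⊥-elim (ℕP.<-irrefl refl (ℕP.<-≤-trans h′ (ℕP.m≤n⇒m≤1+n h)))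
  ... | inj₂ h | inj₂ h′ = trans (ins-high h′) (cong suc (sym (ins-high h)))

  removed-adjacent : (0 <ᵇ suc P) ≡ (suc P <ᵇ suc P) → suc P ≡ suc 0
  removed-adjacent e = ⊥-elim (true≢false (trans e (<ᵇ-false (ℕP.≤-refl {suc P}))))


  removal : PairRemoval M N (suc P) P 0 (suc P)
  removal = record
    { ins = ins ; del = del ; pb≤M = pb≤M ; ps≤N = P≤N ; s<M = s<M ; t<M = t<M ; s≢t = s≢t
    ; ins-< = ins-< ; ins-≢s = ins-≢s ; ins-≢t = ins-≢t ; del-ins = del-ins ; del-< = del-< ; ins-del = ins-del
    ; ins-line = ins-line ; ins-mono = ins-mono ; ins-suc⁻ = ins-suc⁻ ; ins-suc = ins-suc
    ; removed-adjacent = removed-adjacent ; removed-shape = inj₂ (refl , refl) }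

count-pair : ∀ {pb qb ps qs s t} (R : PairRemoval (pb ℕ.+ qb) (ps ℕ.+ qs) pb ps s t) →
  countVecs (pb ℕ.+ qb) (λ v → validMatching pb qb v ∧ (partner v s ≡ᵇ t)) ≡ a ps qs
count-pair {pb} {qb} {ps} {qs} {s} {t} R = begin
  countVecs (pb ℕ.+ qb) (λ v → validMatching pb qb v ∧ (partner v s ≡ᵇ t))
    ≡⟨ count-cong (λ v → validMatching pb qb v ∧ (partner v s ≡ᵇ t)) (λ v → validMatching pb qb v ∧ ((partner v s ≡ᵇ t) ∧ true))
         (λ v → cong (validMatching pb qb v ∧_) (sym (BoolP.∧-identityʳ (partner v s ≡ᵇ t)))) (allVecs (pb ℕ.+ qb) (pb ℕ.+ qb)) ⟩
  countVecs (pb ℕ.+ qb) (λ v → validMatching pb qb v ∧ ((partner v s ≡ᵇ t) ∧ true))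
    ≡⟨ count-valid-removal R (λ _ → true) (λ _ → true) (λ _ _ _ → refl) ⟩
  countVecs (ps ℕ.+ qs) (λ w → validMatching ps qs w ∧ true)
    ≡⟨ count-cong (λ w → validMatching ps qs w ∧ true) (validMatching ps qs)
         (λ w → BoolP.∧-identityʳ (validMatching ps qs w)) (allVecs (ps ℕ.+ qs) (ps ℕ.+ qs)) ⟩
  a ps qs ∎
  where open ≡-Reasoning

count-first-points : ∀ P Q →
  countVecs (suc P ℕ.+ suc Q) (λ v → validMatching (suc P) (suc Q) v ∧ (partner v 0 ≡ᵇ suc P)) ≡ a P Q
count-first-points P Q =
  count-pair (FirstPointsRemoval.removal P (P ℕ.+ Q) (suc P ℕ.+ suc Q) (cong suc (ℕP.+-suc P Q)) (ℕP.m≤m+n P Q))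

first-two-top : ∀ P Q → PairRemoval (suc (suc P) ℕ.+ Q) (P ℕ.+ Q) (suc (suc P)) P 0 1
first-two-top P Q = NeighbourRemoval.removal 0 (P ℕ.+ Q) (suc (suc P) ℕ.+ Q) (suc (suc P)) P refl z≤n
  (ℕP.m≤m+n P Q) (inj₂ (refl , refl))

count-first-two-top : ∀ P Q →
  countVecs (suc (suc P) ℕ.+ Q) (λ v → validMatching (suc (suc P)) Q v ∧ (partner v 0 ≡ᵇ 1)) ≡ a P Q
count-first-two-top P Q = count-pair (first-two-top P Q)

count-first-two-bottom : ∀ P Q →
  countVecs (P ℕ.+ suc (suc Q)) (λ v → validMatching P (suc (suc Q)) v ∧ (partner v P ≡ᵇ suc P)) ≡ a P Q
count-first-two-bottom P Q = count-pair (NeighbourRemoval.removal P (P ℕ.+ Q) (P ℕ.+ suc (suc Q)) P P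
  (trans (ℕP.+-suc P (suc Q)) (cong suc (ℕP.+-suc P Q))) (ℕP.m≤m+n P Q) (ℕP.m≤m+n P Q) (inj₁ (refl , refl)))

-- Both the first two top points and the first two bottom points paired together: removing
-- the top pair leaves a configuration whose first two bottom points are paired.
count-first-two-both : ∀ P Q →
  countVecs (suc (suc P) ℕ.+ suc (suc Q))
    (λ v → validMatching (suc (suc P)) (suc (suc Q)) v ∧ ((partner v 0 ≡ᵇ 1) ∧ (partner v (suc (suc P)) ≡ᵇ suc (suc (suc P)))))
  ≡ a P Q
count-first-two-both P Q =
  trans (count-valid-removal R (λ v → partner v (suc (suc P)) ≡ᵇ suc (suc (suc P))) (λ w → partner w P ≡ᵇ suc P) bottom-pair)
        (count-first-two-bottom P Q)
  where
  R = first-two-top P (suc (suc Q))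
  P<N : P < P ℕ.+ suc (suc Q)
  P<N = ℕP.m<m+n P (s≤s z≤n)
  shifted : ∀ x b → x ≢ 0 → x ≢ 1 → (x ≡ᵇ suc (suc b)) ≡ ((x ∸ 2) ≡ᵇ b)
  shifted zero b x≢0 _ = ⊥-elim (x≢0 refl)
  shifted (suc zero) b _ x≢1 = ⊥-elim (x≢1 refl)
  shifted (suc (suc x)) b _ _ = refl
  bottom-pair : ∀ v → Planar (suc (suc P) ℕ.+ suc (suc Q)) (suc (suc P)) (partner v) → partner v 0 ≡ 1 →
    (partner v (suc (suc P)) ≡ᵇ suc (suc (suc P))) ≡ (partner (Removal.shrink R v) P ≡ᵇ suc P)
  bottom-pair v G v0≡1 = trans
    (shifted (partner v (suc (suc P))) (suc P)
      (Removal.Restrict.partner-≢s R (partner v) G v0≡1 P P<N) (Removal.Restrict.partner-≢t R (partner v) G v0≡1 P P<N))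
    (cong (_≡ᵇ suc P) (sym (Removal.partner-shrink R v G v0≡1 P P<N)))

module FirstTopPoint {P M : ℕ} {f : ℕ → ℕ} (G : Planar M (suc P) f) (1+P<M : suc P < M) where
  open Planar G

  0<M : 0 < M
  0<M = ℕP.≤-<-trans z≤n 1+P<M

  first-bottom-paired : suc P < f 0 → f (suc P) ≡ suc (suc P)
  first-bottom-paired P+1<f0 with f (suc P) ℕ.<? suc P
  ... | yes top with f (suc P) ℕ.≟ 0
  ...   | yes f[P+1]≡0 = ⊥-elim (ℕP.<-irrefl (sym (trans (cong f (sym f[P+1]≡0)) (involutive (suc P) 1+P<M))) P+1<f0)
  ...   | no f[P+1]≢0 = ⊥-elim (ℕP.<-asym P+1<f0 (subst (f 0 <_) (involutive (suc P) 1+P<M)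
            (monotone 0 (f (suc P)) (ℕP.n≢0⇒n>0 f[P+1]≢0) top (ℕP.<⇒≤ P+1<f0)
              (subst (suc P ≤_) (sym (involutive (suc P) 1+P<M)) ℕP.≤-refl))))
  first-bottom-paired P+1<f0 | no bottom
    with adjacent (suc P) 1+P<M (trans (<ᵇ-false (ℕP.≤-refl {suc P})) (sym (<ᵇ-false (ℕP.≮⇒≥ bottom))))
  ... | inj₁ f[P+1]≡P+2 = f[P+1]≡P+2
  ... | inj₂ P+1≡1+f[P+1] = ⊥-elim (bottom (subst (_< suc P) (ℕP.suc-injective P+1≡1+f[P+1]) (ℕP.n<1+n P)))

  classification : f 0 ≡ suc P ⊎ ((1 < suc P × f 0 ≡ 1) ⊎ f (suc P) ≡ suc (suc P))
  classification with f 0 ℕ.≟ suc P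
  ... | yes f0≡P+1 = inj₁ f0≡P+1
  ... | no f0≢P+1 with f 0 ℕ.<? suc P
  ...   | no not-top = inj₂ (inj₂ (first-bottom-paired (ℕP.≤∧≢⇒< (ℕP.≮⇒≥ not-top) (λ e → f0≢P+1 (sym e)))))
  ...   | yes top with adjacent 0 0<M (trans (<ᵇ-true {0} {suc P} (s≤s z≤n)) (sym (<ᵇ-true top)))
  ...     | inj₁ f0≡1 = inj₂ (inj₁ (subst (_< suc P) f0≡1 top , f0≡1))

  A-excludes-B : f 0 ≡ suc P → f 0 ≡ 1 → 1 < suc P → ⊥
  A-excludes-B f0≡P+1 f0≡1 1<P+1 = ℕP.<-irrefl (trans (sym f0≡1) f0≡P+1) 1<P+1

  A-excludes-C : f 0 ≡ suc P → f (suc P) ≡ suc (suc P) → ⊥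
  A-excludes-C f0≡P+1 f[P+1]≡P+2 = ℕP.1+n≢0 (trans (sym f[P+1]≡P+2) (trans (cong f (sym f0≡P+1)) (involutive 0 0<M)))

module Recurrence (P Q : ℕ) where
  private
    M = suc P ℕ.+ suc Q
    1+P<M : suc P < M
    1+P<M = s≤s (ℕP.m<m+n P (s≤s z≤n))

  Valid FirstPoints FirstTwoTop FirstTwoBottom : Vec (Fin M) M → Bool
  Valid = validMatching (suc P) (suc Q)
  FirstPoints v = partner v 0 ≡ᵇ suc P
  FirstTwoTop v = (1 <ᵇ suc P) ∧ (partner v 0 ≡ᵇ 1)
  FirstTwoBottom v = partner v (suc P) ≡ᵇ suc (suc P)

  countTop countBottom countBoth : ℕ
  countTop = countVecs M (λ v → Valid v ∧ FirstTwoTop v)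
  countBottom = countVecs M (λ v → Valid v ∧ FirstTwoBottom v)
  countBoth = countVecs M (λ v → (Valid v ∧ FirstTwoTop v) ∧ (Valid v ∧ FirstTwoBottom v))

  private
    cover : ∀ x y z → (x ≡ true → (y ∨ z) ≡ true) → ((x ∧ y) ∨ (x ∧ z)) ≡ x
    cover false y z _ = refl
    cover true y z h = h refl
    disjoint : ∀ x y z → (x ≡ true → (y ∧ z) ≡ false) → ((x ∧ y) ∧ (x ∧ z)) ≡ false
    disjoint false y z _ = refl
    disjoint true y z h = h refl

  covered : ∀ v → Valid v ≡ true → (FirstPoints v ∨ (FirstTwoTop v ∨ FirstTwoBottom v)) ≡ true
  covered v valid with FirstTopPoint.classification (valid⇒planar (suc P) (suc Q) v valid) 1+P<M
  ... | inj₁ e = cong (_∨ (FirstTwoTop v ∨ FirstTwoBottom v)) (≡ᵇ-true e)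
  ... | inj₂ (inj₁ (1<P+1 , e)) rewrite <ᵇ-true 1<P+1 | ≡ᵇ-true e = BoolP.∨-zeroʳ (FirstPoints v)
  ... | inj₂ (inj₂ e) rewrite ≡ᵇ-true e = trans (cong (FirstPoints v ∨_) (BoolP.∨-zeroʳ (FirstTwoTop v))) (BoolP.∨-zeroʳ (FirstPoints v))

  exclusive : ∀ v → Valid v ≡ true → (FirstPoints v ∧ (FirstTwoTop v ∨ FirstTwoBottom v)) ≡ false
  exclusive v valid with partner v 0 ≡ᵇ suc P in e
  ... | false = refl
  ... | true = trans (cong (_∨ FirstTwoBottom v) not-top) not-bottom
    where
    open FirstTopPoint (valid⇒planar (suc P) (suc Q) v valid) 1+P<M
    f0≡P+1 = ≡ᵇ-true⁻ e
    not-top : FirstTwoTop v ≡ false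
    not-top with 1 <ᵇ suc P in l | partner v 0 ≡ᵇ 1 in e′
    ... | true | true = ⊥-elim (A-excludes-B f0≡P+1 (≡ᵇ-true⁻ e′) (<ᵇ-true⁻ l))
    ... | true | false = refl
    ... | false | _ = refl
    not-bottom : FirstTwoBottom v ≡ false
    not-bottom = ≡ᵇ-false (A-excludes-C f0≡P+1)

  recurrence : a (suc P) (suc Q) ℕ.+ countBoth ≡ a P Q ℕ.+ countTop ℕ.+ countBottom
  recurrence = begin
    a (suc P) (suc Q) ℕ.+ countBoth                   ≡⟨ cong (ℕ._+ countBoth) split-first ⟩
    (countVecs M VA ℕ.+ countVecs M VBC) ℕ.+ countBoth ≡⟨ ℕP.+-assoc (countVecs M VA) (countVecs M VBC) countBoth ⟩
    countVecs M VA ℕ.+ (countVecs M VBC ℕ.+ countBoth) ≡⟨ cong (countVecs M VA ℕ.+_) split-second ⟩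
    countVecs M VA ℕ.+ (countTop ℕ.+ countBottom)      ≡⟨ sym (ℕP.+-assoc (countVecs M VA) countTop countBottom) ⟩
    countVecs M VA ℕ.+ countTop ℕ.+ countBottom        ≡⟨ cong (λ k → k ℕ.+ countTop ℕ.+ countBottom) (count-first-points P Q) ⟩
    a P Q ℕ.+ countTop ℕ.+ countBottom                 ∎
    where
    open ≡-Reasoning
    VA VBC : Vec (Fin M) M → Bool
    VA v = Valid v ∧ FirstPoints v
    VBC v = Valid v ∧ (FirstTwoTop v ∨ FirstTwoBottom v)
    split-first : a (suc P) (suc Q) ≡ countVecs M VA ℕ.+ countVecs M VBC
    split-first = begin
      a (suc P) (suc Q)                                                       ≡⟨ sym (ℕP.+-identityʳ (a (suc P) (suc Q))) ⟩
      countVecs M Valid ℕ.+ 0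
        ≡⟨ cong₂ ℕ._+_ (sym (count-cong (λ v → VA v ∨ VBC v) Valid (λ v → cover (Valid v) (FirstPoints v) (FirstTwoTop v ∨ FirstTwoBottom v) (covered v)) (allVecs M M)))
                       (sym (count-none (λ v → VA v ∧ VBC v) (λ v → disjoint (Valid v) (FirstPoints v) (FirstTwoTop v ∨ FirstTwoBottom v) (exclusive v)) (allVecs M M))) ⟩
      countVecs M (λ v → VA v ∨ VBC v) ℕ.+ countVecs M (λ v → VA v ∧ VBC v) ≡⟨ count-∨ VA VBC (allVecs M M) ⟩
      countVecs M VA ℕ.+ countVecs M VBC                                      ∎
    split-second : countVecs M VBC ℕ.+ countBoth ≡ countTop ℕ.+ countBottom
    split-second = trans
      (cong (ℕ._+ countBoth) (count-cong VBC (λ v → (Valid v ∧ FirstTwoTop v) ∨ (Valid v ∧ FirstTwoBottom v))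
        (λ v → BoolP.∧-distribˡ-∨ (Valid v) (FirstTwoTop v) (FirstTwoBottom v)) (allVecs M M)))
      (count-∨ (λ v → Valid v ∧ FirstTwoTop v) (λ v → Valid v ∧ FirstTwoBottom v) (allVecs M M))

aᴺ : ℤ → ℤ → ℕ
aᴺ (+ p) (+ q) = a p q
aᴺ (+ p) -[1+ q ] = 0
aᴺ -[1+ p ] _ = 0

aℤ≡aᴺ : ∀ k n → aℤ k n ≡ + aᴺ k n
aℤ≡aᴺ (+ p) (+ q) = refl
aℤ≡aᴺ (+ p) -[1+ q ] = refl
aℤ≡aᴺ -[1+ p ] _ = refl

count-implied : ∀ N (V X : Vec (Fin N) N → Bool) → (∀ v → V v ≡ true → X v ≡ true) →
  countVecs N V ≡ countVecs N (λ v → V v ∧ X v)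
count-implied N V X V⇒X = count-cong V (λ v → V v ∧ X v) (λ v → implied (V v) (X v) (V⇒X v)) (allVecs N N)
  where
  implied : ∀ x y → (x ≡ true → y ≡ true) → x ≡ (x ∧ y)
  implied false y _ = refl
  implied true y h = sym (h refl)

-- With only top (or only bottom) points, the first two points are always partners.
a-top-line : ∀ P → a (suc (suc P)) 0 ≡ a P 0
a-top-line P = trans (count-implied _ (validMatching (suc (suc P)) 0) (λ v → partner v 0 ≡ᵇ 1) first-two-paired)
                     (count-first-two-top P 0)
  where
  first-two-paired : ∀ v → validMatching (suc (suc P)) 0 v ≡ true → (partner v 0 ≡ᵇ 1) ≡ true
  first-two-paired v valid
    with Planar.adjacent G 0 (s≤s z≤n) (sym (<ᵇ-true (subst (partner v 0 <_) (ℕP.+-identityʳ _) (Planar.bounded G 0 (s≤s z≤n)))))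
    where G = valid⇒planar (suc (suc P)) 0 v valid
  ... | inj₁ v0≡1 = ≡ᵇ-true v0≡1

a-bottom-line : ∀ Q → a 0 (suc (suc Q)) ≡ a 0 Q
a-bottom-line Q = trans (count-implied _ (validMatching 0 (suc (suc Q))) (λ v → partner v 0 ≡ᵇ 1) first-two-paired)
                        (count-first-two-bottom 0 Q)
  where
  first-two-paired : ∀ v → validMatching 0 (suc (suc Q)) v ≡ true → (partner v 0 ≡ᵇ 1) ≡ true
  first-two-paired v valid with Planar.adjacent (valid⇒planar 0 (suc (suc Q)) v valid) 0 (s≤s z≤n) refl
  ... | inj₁ v0≡1 = ≡ᵇ-true v0≡1

module _ where
  open Recurrence

  countTop≡ : ∀ P Q → countTop P Q ≡ aᴺ (+ P - + 1) (+ suc Q)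
  countTop≡ zero Q = count-none (λ v → Valid 0 Q v ∧ FirstTwoTop 0 Q v) (λ v → BoolP.∧-zeroʳ (Valid 0 Q v)) (allVecs _ _)
  countTop≡ (suc P) Q = count-first-two-top P (suc Q)

  no-bottom-pair : ∀ P (v : Vec (Fin (suc P ℕ.+ 1)) (suc P ℕ.+ 1)) → FirstTwoBottom P 0 v ≡ false
  no-bottom-pair P v = ≡ᵇ-false (λ e → ℕP.<-irrefl e (subst (partner v (suc P) <_) (cong suc (ℕP.+-comm P 1))
                                                         (partner-< v (suc P) (s≤s (ℕP.m<m+n P (s≤s z≤n))))))

  countBottom≡ : ∀ P Q → countBottom P Q ≡ aᴺ (+ suc P) (+ Q - + 1)
  countBottom≡ P zero = count-none (λ v → Valid P 0 v ∧ FirstTwoBottom P 0 v)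
    (λ v → trans (cong (Valid P 0 v ∧_) (no-bottom-pair P v)) (BoolP.∧-zeroʳ (Valid P 0 v))) (allVecs _ _)
  countBottom≡ P (suc Q) = count-first-two-bottom (suc P) Q

  countBoth≡ : ∀ P Q → countBoth P Q ≡ aᴺ (+ P - + 1) (+ Q - + 1)
  countBoth≡ zero Q = count-none _ (λ v → cong (_∧ (Valid 0 Q v ∧ FirstTwoBottom 0 Q v)) (BoolP.∧-zeroʳ (Valid 0 Q v))) (allVecs _ _)
  countBoth≡ (suc P) zero = count-none _
    (λ v → trans (cong (λ c → (Valid (suc P) 0 v ∧ FirstTwoTop (suc P) 0 v) ∧ (Valid (suc P) 0 v ∧ c)) (no-bottom-pair (suc P) v))
                 (trans (cong ((Valid (suc P) 0 v ∧ FirstTwoTop (suc P) 0 v) ∧_) (BoolP.∧-zeroʳ (Valid (suc P) 0 v)))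
                        (BoolP.∧-zeroʳ _)))
    (allVecs _ _)
  countBoth≡ (suc P) (suc Q) = trans
    (count-cong _ _ (λ v → regroup (Valid (suc P) (suc Q) v) (partner v 0 ≡ᵇ 1) (FirstTwoBottom (suc P) (suc Q) v)) (allVecs _ _))
    (count-first-two-both P Q)
    where
    regroup : ∀ x y z → ((x ∧ (true ∧ y)) ∧ (x ∧ z)) ≡ (x ∧ (y ∧ z))
    regroup false y z = refl
    regroup true y z = refl

-- The recurrence at non-negative indices, in ℕ with the subtracted term moved to the left.
recurrence-ℕ : ∀ K M → a (suc K) (suc M) ℕ.+ aᴺ (+ K - + 1) (+ M - + 1)
                       ≡ a K M ℕ.+ aᴺ (+ K - + 1) (+ suc M) ℕ.+ aᴺ (+ suc K) (+ M - + 1)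
recurrence-ℕ K M = begin
  a (suc K) (suc M) ℕ.+ aᴺ (+ K - + 1) (+ M - + 1)   ≡⟨ cong (a (suc K) (suc M) ℕ.+_) (sym (countBoth≡ K M)) ⟩
  a (suc K) (suc M) ℕ.+ Recurrence.countBoth K M     ≡⟨ Recurrence.recurrence K M ⟩
  a K M ℕ.+ Recurrence.countTop K M ℕ.+ Recurrence.countBottom K M
    ≡⟨ cong₂ (λ x y → a K M ℕ.+ x ℕ.+ y) (countTop≡ K M) (countBottom≡ K M) ⟩
  a K M ℕ.+ aᴺ (+ K - + 1) (+ suc M) ℕ.+ aᴺ (+ suc K) (+ M - + 1) ∎
  where open ≡-Reasoning

+-+1 : ∀ K → + K + + 1 ≡ + suc K
+-+1 K = cong +_ (ℕP.+-comm K 1)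

recurrenceᴺ : ∀ k n → ¬ (k ≡ -[1+ 0 ] × n ≡ -[1+ 0 ]) →
  aᴺ (k + + 1) (n + + 1) ℕ.+ aᴺ (k - + 1) (n - + 1) ≡ aᴺ k n ℕ.+ aᴺ (k - + 1) (n + + 1) ℕ.+ aᴺ (k + + 1) (n - + 1)
recurrenceᴺ (+ K) (+ M) _ =
  subst₂ (λ k′ n′ → aᴺ k′ n′ ℕ.+ aᴺ (+ K - + 1) (+ M - + 1) ≡ a K M ℕ.+ aᴺ (+ K - + 1) n′ ℕ.+ aᴺ k′ (+ M - + 1))
    (sym (+-+1 K)) (sym (+-+1 M)) (recurrence-ℕ K M)
recurrenceᴺ (+ zero) -[1+ 0 ] _ = refl
recurrenceᴺ (+ suc K) -[1+ 0 ] _ =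
  subst (λ k′ → aᴺ k′ (+ 0) ℕ.+ 0 ≡ a K 0 ℕ.+ 0) (sym (+-+1 (suc K))) (cong (ℕ._+ 0) (a-top-line K))
recurrenceᴺ (+ zero) -[1+ suc m ] _ = refl
recurrenceᴺ (+ suc K) -[1+ suc m ] _ = refl
recurrenceᴺ -[1+ 0 ] (+ zero) _ = refl
recurrenceᴺ -[1+ 0 ] (+ suc M) _ =
  subst (λ n′ → aᴺ (+ 0) n′ ℕ.+ 0 ≡ a 0 M) (sym (+-+1 (suc M))) (trans (ℕP.+-identityʳ (a 0 (suc (suc M)))) (a-bottom-line M))
recurrenceᴺ -[1+ 0 ] -[1+ 0 ] excluded = ⊥-elim (excluded (refl , refl))
recurrenceᴺ -[1+ 0 ] -[1+ suc m ] _ = refl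
recurrenceᴺ -[1+ suc k ] n _ = refl

solve-for : ∀ x y z w u → x ℕ.+ u ≡ y ℕ.+ z ℕ.+ w → + x ≡ + y + + z + + w - + u
solve-for x y z w u e = trans (sym (cancel (+ x) (+ u))) (cong (λ m → + m - + u) e)
  where
  cancel : ∀ X U → X + U - U ≡ X
  cancel = solve-∀

mainTheorem14 : (k n : ℤ) → ¬ (k ≡ -[1+ 0 ] × n ≡ -[1+ 0 ]) →
    aℤ (k + + 1) (n + + 1)
      ≡ aℤ k n + aℤ (k - + 1) (n + + 1) + aℤ (k + + 1) (n - + 1) - aℤ (k - + 1) (n - + 1)
mainTheorem14 k n excluded
  rewrite aℤ≡aᴺ (k + + 1) (n + + 1) | aℤ≡aᴺ k n | aℤ≡aᴺ (k - + 1) (n + + 1)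
        | aℤ≡aᴺ (k + + 1) (n - + 1) | aℤ≡aᴺ (k - + 1) (n - + 1) =
  solve-for (aᴺ (k + + 1) (n + + 1)) (aᴺ k n) (aᴺ (k - + 1) (n + + 1)) (aᴺ (k + + 1) (n - + 1)) (aᴺ (k - + 1) (n - + 1))
    (recurrenceᴺ k n excluded)
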